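{- Let $q$ be a prime power, $d\ge 0$ an integer and $p\in[0,1]$. Let $V$ be a random subset of $\mathrm{GF}(q)^d$ obtained by including each of the $q^d$ vectors (including the zero vector) independently with probability $p$. Then the expected number of subsets $A\subseteq V$ that span $\mathrm{GF}(q)^d$ equals $$ \sum_{k=0}^d {\binom {d}{k}}_q (-1)^k q^{\binom {k}{2}} (1 + p)^{q^{d-k}}. $$
   Context: ${\binom{d}{k}}_q$ denotes the Gaussian binomial coefficient $\frac{[d!]_q}{[k!]_q[(d-k)!]_q}$ with $[n!]_q=(1-q)(1-q^2)\cdots(1-q^n)$ (the number of $k$-dimensional subspaces of $\mathrm{GF}(q)^d$). A subset $A$ spans $\mathrm{GF}(q)^d$ if its linear span is all of $\mathrm{GF}(q)^d$ (for $d=0$ the empty set spans).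
   Formalization: The probability p ranges over the rationals between 0 and 1 rather than over all reals in [0,1]. -}

module Defs where

open import Data.Nat as ℕ using (ℕ; zero; suc; _∸_)
open import Data.Nat.Primality using (Prime)
open import Data.Nat.Combinatorics using (_C_)
open import Data.Fin using (Fin; _≟_; finToFun)
open import Data.Fin.Properties using (any?; all?)
open import Data.Fin.Subset using (Subset; _∈_; _∉_; _⊆_; ∣_∣; inside; outside)
open import Data.Fin.Subset.Properties using (_∈?_; _⊆?_)
open import Data.Vec using (Vec; []; _∷_; lookup)
open import Data.List using (List; []; _∷_; _++_; map; filter; length; foldr)
open import Data.Product using (Σ; ∃; _×_; _,_)
open import Data.Integer using (+_)
open import Data.Rational using (ℚ; 0ℚ; 1ℚ; _+_; _*_; _-_; -_; _÷_; ≢-nonZero) renaming (_≟_ to _≟ℚ_)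
open import Data.Rational using () renaming (_/_ to _/ℚ_)
open import Algebra.Structures using (IsCommutativeRing)
open import Relation.Binary.PropositionalEquality using (_≡_; _≢_)
open import Relation.Nullary using (Dec; yes; no; ¬_)
open import Relation.Nullary.Decidable using (map′; _×-dec_; _→-dec_; ¬?)

IsPrimePower : ℕ → Set
IsPrimePower q = ∃ λ r → ∃ λ k → Prime r × (1 ℕ.≤ k) × (q ≡ r ℕ.^ k)

-- A field structure with exactly q elements, carried by Fin q
-- (every finite field of order q is isomorphic to one of this form).

record FieldOn (q : ℕ) : Set where
  infixl 6 _+F_
  infixl 7 _*F_
  field
    _+F_ _*F_   : Fin q → Fin q → Fin q
    -F_         : Fin q → Fin q
    0F 1F       : Fin q
    isCommRing  : IsCommutativeRing _≡_ _+F_ _*F_ -F_ 0F 1F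
    0≢1         : 0F ≢ 1F
    inverse     : ∀ x → x ≢ 0F → ∃ λ y → x *F y ≡ 1F

∃Vec? : ∀ {m n} {P : Vec (Fin m) n → Set} →
        (∀ v → Dec (P v)) → Dec (∃ P)
∃Vec? {n = zero}  P? = map′ (λ p → [] , p) (λ { ([] , p) → p }) (P? [])
∃Vec? {n = suc n} P? =
  map′ (λ { (a , xs , p) → a ∷ xs , p })
       (λ { (a ∷ xs , p) → a , xs , p })
       (any? (λ a → ∃Vec? (λ xs → P? (a ∷ xs))))

∀Vec? : ∀ {m n} {P : Vec (Fin m) n → Set} →
        (∀ v → Dec (P v)) → Dec (∀ v → P v)
∀Vec? {n = zero}  P? = map′ (λ { p [] → p }) (λ f → f []) (P? [])
∀Vec? {n = suc n} P? =
  map′ (λ { f (a ∷ xs) → f a xs })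
       (λ f a xs → f (a ∷ xs))
       (all? (λ a → ∀Vec? (λ xs → P? (a ∷ xs))))

module _ {q : ℕ} (F : FieldOn q) (d : ℕ) where
  open FieldOn F

  N : ℕ
  N = q ℕ.^ d

  -- the i-th vector of GF(q)^d (finToFun is a bijection Fin (q^d) ≅ (Fin d → Fin q))
  vecOf : Fin N → Fin d → Fin q
  vecOf = finToFun

  ΣF : ∀ {n} → (Fin n → Fin q) → Fin q
  ΣF {zero}  f = 0F
  ΣF {suc n} f = f Fin.zero +F ΣF (λ i → f (Fin.suc i))
    where import Data.Fin as Fin

  linComb : Vec (Fin q) N → Fin d → Fin q
  linComb c j = ΣF (λ i → lookup c i *F vecOf i j)

  Spans : Subset N → Set
  Spans A = ∀ (v : Vec (Fin q) d) → ∃ λ (c : Vec (Fin q) N) →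
              (∀ i → i ∉ A → lookup c i ≡ 0F) × (∀ j → linComb c j ≡ lookup v j)

  Spans? : ∀ A → Dec (Spans A)
  Spans? A = ∀Vec? λ v → ∃Vec? λ c →
    all? (λ i → ¬? (i ∈? A) →-dec (lookup c i ≟ 0F))
    ×-dec all? (λ j → linComb c j ≟ lookup v j)

allSubsets : ∀ n → List (Subset n)
allSubsets zero    = [] ∷ []
allSubsets (suc n) = map (outside ∷_) (allSubsets n) ++ map (inside ∷_) (allSubsets n)

ℕ→ℚ : ℕ → ℚ
ℕ→ℚ n = (+ n) /ℚ 1

infixr 8 _^ℚ_
_^ℚ_ : ℚ → ℕ → ℚ
x ^ℚ zero  = 1ℚ
x ^ℚ suc n = x * (x ^ℚ n)

sumℚ : List ℚ → ℚ
sumℚ = foldr _+_ 0ℚ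

Σ≤ : ℕ → (ℕ → ℚ) → ℚ
Σ≤ zero    f = f 0
Σ≤ (suc n) f = Σ≤ n f + f (suc n)

-- division, total (returns 0 on a zero denominator; never used with one here)
_div_ : ℚ → ℚ → ℚ
a div b with b ≟ℚ 0ℚ
... | yes _  = 0ℚ
... | no b≢0 = _÷_ a b {{≢-nonZero b≢0}}

qFact : ℕ → ℕ → ℚ
qFact q zero    = 1ℚ
qFact q (suc n) = qFact q n * (1ℚ - ℕ→ℚ q ^ℚ suc n)

gaussBinom : ℕ → ℕ → ℕ → ℚ
gaussBinom q d k = qFact q d div (qFact q k * qFact q (d ∸ k))

spanningCount : ∀ {q} (F : FieldOn q) d → Subset (N F d) → ℕ
spanningCount F d V =
  length (filter (λ A → (A ⊆? V) ×-dec Spans? F d A) (allSubsets (N F d)))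

probOf : ∀ {n} → ℚ → Subset n → ℚ
probOf {n} p S = p ^ℚ ∣ S ∣ * (1ℚ - p) ^ℚ (n ∸ ∣ S ∣)

expectedSpanning : ∀ {q} (F : FieldOn q) d → ℚ → ℚ
expectedSpanning F d p =
  sumℚ (map (λ S → probOf p S * ℕ→ℚ (spanningCount F d S)) (allSubsets (N F d)))

formula : ℕ → ℕ → ℚ → ℚ
formula q d p = Σ≤ d λ k →
  gaussBinom q d k * (- 1ℚ) ^ℚ k * ℕ→ℚ (q ℕ.^ (k C 2)) * (1ℚ + p) ^ℚ (q ℕ.^ (d ∸ k))

{-# OPTIONS --safe #-}
module Submission where

-- Taking expectations termwise, E[#{A ⊆ V : A spans}] = Σ_A p^|A| [A spans] = S_d(p), where
-- S_d(w) = Σ_{A spans GF(q)^d} w^|A|.  A set B ⊆ GF(q)^(d+1) spans iff its projection π B onto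
-- the last d coordinates spans and B lies on no hyperplane x₀ = c · x′; when π B spans, B lies
-- on at most one of them.  A point of π B is hit by a nonempty set of its q lifts, of total
-- weight (1 + w)^q - 1, while a B on the hyperplane of c is the graph of π B over it.  Summing
-- over the fibres of π gives
--   S_(d+1)(w) = S_d((1 + w)^q - 1) - q^d S_d(w),   S_0(w) = 1 + w.
-- By the q-Pascal rule Φ_d(Y) = Σ_k [d k]_q (-1)^k q^(k choose 2) Y^(q^(d-k)) satisfies
--   Φ_(d+1)(Y) = Φ_d(Y^q) - q^d Φ_d(Y),   Φ_0(Y) = Y,
-- so S_d(w) = Φ_d(1 + w).

open import Defs
open import Algebra.Bundles using (CommutativeRing)
import Algebra.Properties.AbelianGroup
import Algebra.Properties.Group
import Algebra.Properties.Ring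
open import Algebra.Structures using (IsCommutativeRing)
open import Data.Bool using (true; false; if_then_else_)
open import Data.Empty using (⊥-elim)
open import Data.Fin as Fin using (Fin; zero; suc; toℕ; _↑ˡ_; _↑ʳ_; combine; quotient; remainder)
import Data.Fin.Properties as FinP
open import Data.Fin.Subset using (Subset; inside; outside; _∈_; _∉_; _⊆_; ∣_∣; _∪_; ⊥)
open import Data.Fin.Subset.Properties using (_⊆?_)
import Data.Fin.Subset.Properties as SubsetP
open import Data.List as List using (List; []; _∷_)
import Data.List.Properties as ListP
open import Data.Nat as ℕ using (ℕ)
open import Data.Nat.Combinatorics using (nC1≡n; nCk+nC[k+1]≡[n+1]C[k+1]) renaming (_C_ to _choose_)
open import Data.Nat.Primality using (prime⇒nonTrivial)
import Data.Nat.Properties as ℕP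
open import Data.Product using (∃; _×_; _,_; proj₁; proj₂)
open import Data.Sum using (inj₁; inj₂)
open import Data.Vec using ([]; _∷_; _++_; lookup; take; drop; splitAt; here; there)
import Data.Vec as Vec
import Data.Vec.Properties as VecP
open import Data.Vec.Functional as Vector using (Vector) renaming (_∷_ to _∷ᶠ_)
open import Level using (0ℓ)
open import Relation.Binary.PropositionalEquality as ≡ using (_≡_; _≢_)
open import Relation.Nullary using (Dec; yes; no; does; ¬_)
open import Relation.Nullary.Decidable using (_×-dec_; dec-true)

module FinSum {c ℓ} (R : CommutativeRing c ℓ) where
  open CommutativeRing R hiding (zero)
  open import Algebra.Properties.Semiring.Sum semiring public
  open import Relation.Binary.Reasoning.Setoid setoid
  open import Algebra.Properties.Group +-group using (ε⁻¹≈ε)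
  open import Algebra.Properties.AbelianGroup +-abelianGroup using (⁻¹-∙-comm)

  sum-+ : ∀ {n} (f g : Vector Carrier n) → sum (λ i → f i + g i) ≈ sum f + sum g
  sum-+ {ℕ.zero}  f g = sym (+-identityˡ 0#)
  sum-+ {ℕ.suc n} f g = begin
    (f zero + g zero) + sum (λ i → f (suc i) + g (suc i))
      ≈⟨ +-congˡ (sum-+ (λ i → f (suc i)) (λ i → g (suc i))) ⟩
    (f zero + g zero) + (sum (λ i → f (suc i)) + sum (λ i → g (suc i)))
      ≈⟨ +-assoc _ _ _ ⟩
    f zero + (g zero + (sum (λ i → f (suc i)) + sum (λ i → g (suc i))))
      ≈⟨ +-congˡ (trans (sym (+-assoc _ _ _)) (trans (+-congʳ (+-comm _ _)) (+-assoc _ _ _))) ⟩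
    f zero + (sum (λ i → f (suc i)) + (g zero + sum (λ i → g (suc i))))
      ≈⟨ sym (+-assoc _ _ _) ⟩
    sum f + sum g ∎

  sum-neg : ∀ {n} (f : Vector Carrier n) → sum (λ i → - f i) ≈ - sum f
  sum-neg {ℕ.zero}  f = sym ε⁻¹≈ε
  sum-neg {ℕ.suc n} f = trans (+-congˡ (sum-neg (λ i → f (suc i)))) (⁻¹-∙-comm (f zero) _)

  sum-- : ∀ {n} (f g : Vector Carrier n) → sum (λ i → f i - g i) ≈ sum f - sum g
  sum-- f g = trans (sum-+ f (λ i → - g i)) (+-congˡ (sum-neg g))

  δ : ∀ {n} → Fin n → Fin n → Carrier
  δ i j = if does (i Fin.≟ j) then 1# else 0#

  δ-sym : ∀ {n} (i j : Fin n) → δ i j ≡ δ j i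
  δ-sym i j with i Fin.≟ j | j Fin.≟ i
  ... | yes _    | yes _    = ≡.refl
  ... | no _     | no _     = ≡.refl
  ... | yes i≡j  | no j≢i   = ⊥-elim (j≢i (≡.sym i≡j))
  ... | no i≢j   | yes j≡i  = ⊥-elim (i≢j (≡.sym j≡i))

  sum-*δ : ∀ {n} (f : Vector Carrier n) j → sum (λ i → f i * δ i j) ≈ f j
  sum-*δ {ℕ.suc n} f zero = begin
    f zero * 1# + sum (λ i → f (suc i) * 0#)
      ≈⟨ +-cong (*-identityʳ _) (trans (sum-cong-≋ (λ i → zeroʳ (f (suc i)))) (sum-replicate-zero n)) ⟩
    f zero + 0#
      ≈⟨ +-identityʳ _ ⟩
    f zero ∎
  sum-*δ {ℕ.suc n} f (suc j) = begin
    f zero * 0# + sum (λ i → f (suc i) * δ i j)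
      ≈⟨ +-cong (zeroʳ _) (sum-*δ (λ i → f (suc i)) j) ⟩
    0# + f (suc j)
      ≈⟨ +-identityˡ _ ⟩
    f (suc j) ∎

import Data.Rational.Properties as ℚP
open import Algebra.Apartness.Properties.HeytingCommutativeRing ℚP.heytingCommutativeRing using (x#0y#0→xy#0)
open import Algebra.Properties.Ring (CommutativeRing.ring ℚP.+-*-commutativeRing) using (x[y-z]≈xy-xz)
open import Algebra.Properties.Semiring.Exp (CommutativeRing.semiring ℚP.+-*-commutativeRing)
  using (_^_; ^-homo-*; ^-assocʳ)
open import Algebra.Properties.Semiring.Mult (CommutativeRing.semiring ℚP.+-*-commutativeRing)
  using (×1-homo-*; ×-assoc-*) renaming (_×_ to _×ℚ_)
import Data.Integer as ℤ
import Data.Integer.Properties as ℤP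
import Data.Nat.Coprimality as Coprime
open import Data.Rational using (ℚ; mkℚ; 0ℚ; 1ℚ; _≤_; _+_; _*_; _-_; -_; 1/_; ↥_; toℚᵘ; ≢-nonZero)
  renaming (_≟_ to _≟ℚ_)
open import Data.Rational.Solver using (module +-*-Solver)
import Data.Rational.Unnormalised as ℚᵘ
import Data.Rational.Unnormalised.Properties as ℚᵘP
open import Relation.Binary.PropositionalEquality using (refl; sym; trans; cong; cong₂; subst; module ≡-Reasoning)

open FinSum ℚP.+-*-commutativeRing
  using (sum; sum-cong-≗; sum--; *-distribˡ-sum; sum-replicate; sum-replicate-zero; sum-init-last; sum-*δ)

ℕ→ℚ≡mkℚ : ∀ n → ℕ→ℚ n ≡ mkℚ (ℤ.+ n) 0 (Coprime.sym (Coprime.1-coprimeTo n))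
ℕ→ℚ≡mkℚ n = ℚP.normalize-coprime (Coprime.sym (Coprime.1-coprimeTo n))

ℕ→ℚ-suc : ∀ n → ℕ→ℚ (ℕ.suc n) ≡ 1ℚ + ℕ→ℚ n
ℕ→ℚ-suc n = ℚP.toℚᵘ-injective (begin
  toℚᵘ (ℕ→ℚ (ℕ.suc n))                   ≡⟨ cong toℚᵘ (ℕ→ℚ≡mkℚ (ℕ.suc n)) ⟩
  ℚᵘ.mkℚᵘ (ℤ.+ ℕ.suc n) 0                  ≈⟨ ℚᵘ.*≡* (cong (λ m → (ℤ.+ 1 ℤ.+ m) ℤ.* ℤ.+ 1) (sym (ℤP.*-identityʳ (ℤ.+ n)))) ⟩
  ℚᵘ.mkℚᵘ (ℤ.+ 1) 0 ℚᵘ.+ ℚᵘ.mkℚᵘ (ℤ.+ n) 0 ≡⟨ cong (ℚᵘ.mkℚᵘ (ℤ.+ 1) 0 ℚᵘ.+_) (cong toℚᵘ (sym (ℕ→ℚ≡mkℚ n))) ⟩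
  toℚᵘ 1ℚ ℚᵘ.+ toℚᵘ (ℕ→ℚ n)               ≈⟨ ℚᵘP.≃-sym (ℚP.toℚᵘ-homo-+ 1ℚ (ℕ→ℚ n)) ⟩
  toℚᵘ (1ℚ + ℕ→ℚ n)                       ∎)
  where open import Relation.Binary.Reasoning.Setoid ℚᵘP.≃-setoid

ℕ→ℚ-injective : ∀ {m n} → ℕ→ℚ m ≡ ℕ→ℚ n → m ≡ n
ℕ→ℚ-injective {m} {n} eq =
  ℤP.+-injective (cong ↥_ (trans (sym (ℕ→ℚ≡mkℚ m)) (trans eq (ℕ→ℚ≡mkℚ n))))

ℕ→ℚ≡×1 : ∀ n → ℕ→ℚ n ≡ n ×ℚ 1ℚ
ℕ→ℚ≡×1 ℕ.zero    = refl
ℕ→ℚ≡×1 (ℕ.suc n) = trans (ℕ→ℚ-suc n) (cong (1ℚ +_) (ℕ→ℚ≡×1 n))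

ℕ→ℚ-* : ∀ m n → ℕ→ℚ (m ℕ.* n) ≡ ℕ→ℚ m * ℕ→ℚ n
ℕ→ℚ-* m n = trans (ℕ→ℚ≡×1 (m ℕ.* n))
  (trans (×1-homo-* m n) (sym (cong₂ _*_ (ℕ→ℚ≡×1 m) (ℕ→ℚ≡×1 n))))

^ℚ≡^ : ∀ x n → x ^ℚ n ≡ x ^ n
^ℚ≡^ x ℕ.zero    = refl
^ℚ≡^ x (ℕ.suc n) = cong (x *_) (^ℚ≡^ x n)

^ℚ-+ : ∀ x m n → x ^ℚ (m ℕ.+ n) ≡ x ^ℚ m * x ^ℚ n
^ℚ-+ x m n = trans (^ℚ≡^ x (m ℕ.+ n))
  (trans (^-homo-* x m n) (sym (cong₂ _*_ (^ℚ≡^ x m) (^ℚ≡^ x n))))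

^ℚ-* : ∀ x m n → (x ^ℚ m) ^ℚ n ≡ x ^ℚ (m ℕ.* n)
^ℚ-* x m n = trans (^ℚ≡^ (x ^ℚ m) n)
  (trans (cong (_^ n) (^ℚ≡^ x m)) (trans (^-assocʳ x m n) (sym (^ℚ≡^ x (m ℕ.* n)))))

ℕ→ℚ-^ : ∀ m n → ℕ→ℚ (m ℕ.^ n) ≡ ℕ→ℚ m ^ℚ n
ℕ→ℚ-^ m ℕ.zero    = refl
ℕ→ℚ-^ m (ℕ.suc n) = trans (ℕ→ℚ-* m (m ℕ.^ n)) (cong (ℕ→ℚ m *_) (ℕ→ℚ-^ m n))

sum-const : ∀ n (c : ℚ) → sum {n} (λ _ → c) ≡ ℕ→ℚ n * c
sum-const n c = trans (sum-replicate n)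
  (trans (sym (cong (n ×ℚ_) (ℚP.*-identityˡ c))) (sym (trans (cong (_* c) (ℕ→ℚ≡×1 n)) (×-assoc-* n 1ℚ c))))

𝟙 : ∀ {P : Set} → Dec P → ℚ
𝟙 P? = if does P? then 1ℚ else 0ℚ

𝟙-yes : ∀ {P : Set} (P? : Dec P) → P → 𝟙 P? ≡ 1ℚ
𝟙-yes (yes _) _ = refl
𝟙-yes (no ¬p) p = ⊥-elim (¬p p)

𝟙-no : ∀ {P : Set} (P? : Dec P) → ¬ P → 𝟙 P? ≡ 0ℚ
𝟙-no (yes p) ¬p = ⊥-elim (¬p p)
𝟙-no (no _)  _  = refl

𝟙-× : ∀ {P Q : Set} (P? : Dec P) (Q? : Dec Q) → 𝟙 (P? ×-dec Q?) ≡ 𝟙 P? * 𝟙 Q?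
𝟙-× (yes _) (yes _) = refl
𝟙-× (yes _) (no _)  = refl
𝟙-× (no _)  (yes _) = refl
𝟙-× (no _)  (no _)  = refl

𝟙-⇔ : ∀ {P Q : Set} (P? : Dec P) (Q? : Dec Q) → (P → Q) → (Q → P) → 𝟙 P? ≡ 𝟙 Q?
𝟙-⇔ (yes _) (yes _) _ _ = refl
𝟙-⇔ (yes p) (no ¬q) f _ = ⊥-elim (¬q (f p))
𝟙-⇔ (no ¬p) (yes q) _ g = ⊥-elim (¬p (g q))
𝟙-⇔ (no _)  (no _)  _ _ = refl

∑ₛ : ∀ {n} → (Subset n → ℚ) → ℚ
∑ₛ {ℕ.zero}  f = f []
∑ₛ {ℕ.suc n} f = ∑ₛ (λ A → f (outside ∷ A)) + ∑ₛ (λ A → f (inside ∷ A))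

∑ₛ-cong : ∀ {n} {f g : Subset n → ℚ} → (∀ A → f A ≡ g A) → ∑ₛ f ≡ ∑ₛ g
∑ₛ-cong {ℕ.zero}  f≗g = f≗g []
∑ₛ-cong {ℕ.suc n} f≗g = cong₂ _+_ (∑ₛ-cong (λ A → f≗g (outside ∷ A))) (∑ₛ-cong (λ A → f≗g (inside ∷ A)))

∑ₛ-0 : ∀ {n} → ∑ₛ {n} (λ _ → 0ℚ) ≡ 0ℚ
∑ₛ-0 {ℕ.zero}  = refl
∑ₛ-0 {ℕ.suc n} = cong₂ _+_ (∑ₛ-0 {n}) (∑ₛ-0 {n})

∑ₛ-+ : ∀ {n} (f g : Subset n → ℚ) → ∑ₛ (λ A → f A + g A) ≡ ∑ₛ f + ∑ₛ g
∑ₛ-+ {ℕ.zero}  f g = refl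
∑ₛ-+ {ℕ.suc n} f g = trans
  (cong₂ _+_ (∑ₛ-+ (λ A → f (outside ∷ A)) (λ A → g (outside ∷ A)))
             (∑ₛ-+ (λ A → f (inside ∷ A)) (λ A → g (inside ∷ A))))
  (+-interchange (∑ₛ (λ A → f (outside ∷ A))) (∑ₛ (λ A → g (outside ∷ A)))
                 (∑ₛ (λ A → f (inside ∷ A))) (∑ₛ (λ A → g (inside ∷ A))))
  where
  open +-*-Solver
  +-interchange : ∀ a b c d → (a + b) + (c + d) ≡ (a + c) + (b + d)
  +-interchange = solve 4 (λ a b c d → (a :+ b) :+ (c :+ d) := (a :+ c) :+ (b :+ d)) refl

∑ₛ-* : ∀ {n} c (f : Subset n → ℚ) → ∑ₛ (λ A → c * f A) ≡ c * ∑ₛ f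
∑ₛ-* {ℕ.zero}  c f = refl
∑ₛ-* {ℕ.suc n} c f = trans
  (cong₂ _+_ (∑ₛ-* c (λ A → f (outside ∷ A))) (∑ₛ-* c (λ A → f (inside ∷ A))))
  (sym (ℚP.*-distribˡ-+ c _ _))

∑ₛ-*-assoc : ∀ {n} c (f g : Subset n → ℚ) → ∑ₛ (λ A → (c * f A) * g A) ≡ c * ∑ₛ (λ A → f A * g A)
∑ₛ-*-assoc c f g = trans (∑ₛ-cong (λ A → ℚP.*-assoc c (f A) (g A))) (∑ₛ-* c (λ A → f A * g A))

∑ₛ-- : ∀ {n} (f g : Subset n → ℚ) → ∑ₛ (λ A → f A - g A) ≡ ∑ₛ f - ∑ₛ g
∑ₛ-- {ℕ.zero}  f g = refl
∑ₛ-- {ℕ.suc n} f g = trans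
  (cong₂ _+_ (∑ₛ-- (λ A → f (outside ∷ A)) (λ A → g (outside ∷ A)))
             (∑ₛ-- (λ A → f (inside ∷ A)) (λ A → g (inside ∷ A))))
  (-‿interchange (∑ₛ (λ A → f (outside ∷ A))) (∑ₛ (λ A → g (outside ∷ A)))
                 (∑ₛ (λ A → f (inside ∷ A))) (∑ₛ (λ A → g (inside ∷ A))))
  where
  open +-*-Solver
  -‿interchange : ∀ a b c d → (a - b) + (c - d) ≡ (a + c) - (b + d)
  -‿interchange = solve 4 (λ a b c d → (a :- b) :+ (c :- d) := (a :+ c) :- (b :+ d)) refl

∑ₛ-++ : ∀ m {n} (f : Subset (m ℕ.+ n) → ℚ) → ∑ₛ f ≡ ∑ₛ {m} (λ B → ∑ₛ {n} (λ C → f (B ++ C)))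
∑ₛ-++ ℕ.zero        f = refl
∑ₛ-++ (ℕ.suc m) {n} f =
  cong₂ _+_ (∑ₛ-++ m {n} (λ A → f (outside ∷ A))) (∑ₛ-++ m {n} (λ A → f (inside ∷ A)))

∑ₛ-sum-comm : ∀ {m n} (f : Fin n → Subset m → ℚ) → ∑ₛ (λ A → sum (λ i → f i A)) ≡ sum (λ i → ∑ₛ (f i))
∑ₛ-sum-comm {m} {ℕ.zero}  f = ∑ₛ-0 {m}
∑ₛ-sum-comm {m} {ℕ.suc n} f =
  trans (∑ₛ-+ (f zero) _) (cong (∑ₛ (f zero) +_) (∑ₛ-sum-comm (λ i → f (suc i))))

sumℚ-++ : ∀ (xs ys : List ℚ) → sumℚ (xs List.++ ys) ≡ sumℚ xs + sumℚ ys
sumℚ-++ []       ys = sym (ℚP.+-identityˡ _)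
sumℚ-++ (x ∷ xs) ys = trans (cong (x +_) (sumℚ-++ xs ys)) (sym (ℚP.+-assoc x _ _))

sumℚ-allSubsets : ∀ n (f : Subset n → ℚ) → sumℚ (List.map f (allSubsets n)) ≡ ∑ₛ f
sumℚ-allSubsets ℕ.zero    f = ℚP.+-identityʳ (f [])
sumℚ-allSubsets (ℕ.suc n) f = begin
  sumℚ (List.map f (List.map (outside ∷_) Ss List.++ List.map (inside ∷_) Ss))
    ≡⟨ cong sumℚ (ListP.map-++ f (List.map (outside ∷_) Ss) _) ⟩
  sumℚ (List.map f (List.map (outside ∷_) Ss) List.++ List.map f (List.map (inside ∷_) Ss))
    ≡⟨ sumℚ-++ (List.map f (List.map (outside ∷_) Ss)) _ ⟩
  sumℚ (List.map f (List.map (outside ∷_) Ss)) + sumℚ (List.map f (List.map (inside ∷_) Ss))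
    ≡⟨ cong₂ _+_ (cong sumℚ (sym (ListP.map-∘ Ss))) (cong sumℚ (sym (ListP.map-∘ Ss))) ⟩
  sumℚ (List.map (λ A → f (outside ∷ A)) Ss) + sumℚ (List.map (λ A → f (inside ∷ A)) Ss)
    ≡⟨ cong₂ _+_ (sumℚ-allSubsets n _) (sumℚ-allSubsets n _) ⟩
  ∑ₛ f ∎
  where
  open ≡-Reasoning
  Ss = allSubsets n

length-filter : ∀ {A : Set} {P : A → Set} (P? : ∀ x → Dec (P x)) (xs : List A) →
                ℕ→ℚ (List.length (List.filter P? xs)) ≡ sumℚ (List.map (λ x → 𝟙 (P? x)) xs)
length-filter P? []       = refl
length-filter P? (x ∷ xs) with does (P? x)
... | true  = trans (ℕ→ℚ-suc (List.length (List.filter P? xs))) (cong (1ℚ +_) (length-filter P? xs))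
... | false = trans (length-filter P? xs) (sym (ℚP.+-identityˡ _))

module _ (p : ℚ) where

  probOf-outside : ∀ {n} (S : Subset n) → probOf p (outside ∷ S) ≡ (1ℚ - p) * probOf p S
  probOf-outside {n} S = trans
    (cong (λ e → p ^ℚ ∣ S ∣ * (1ℚ - p) ^ℚ e) (ℕP.+-∸-assoc 1 (SubsetP.∣p∣≤n S)))
    (swap (p ^ℚ ∣ S ∣) (1ℚ - p) ((1ℚ - p) ^ℚ (n ℕ.∸ ∣ S ∣)))
    where
    open +-*-Solver
    swap : ∀ a b c → a * (b * c) ≡ b * (a * c)
    swap = solve 3 (λ a b c → a :* (b :* c) := b :* (a :* c)) refl

  probOf-inside : ∀ {n} (S : Subset n) → probOf p (inside ∷ S) ≡ p * probOf p S
  probOf-inside S = ℚP.*-assoc p _ _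

  ∑ₛ-probOf-∑⊆ : ∀ {n} (h : Subset n → ℚ) →
    ∑ₛ (λ S → probOf p S * ∑ₛ (λ A → 𝟙 (A ⊆? S) * h A)) ≡ ∑ₛ (λ A → p ^ℚ ∣ A ∣ * h A)
  ∑ₛ-probOf-∑⊆ {ℕ.zero}  h = ℚP.*-identityˡ (1ℚ * h [])
  ∑ₛ-probOf-∑⊆ {ℕ.suc n} h = begin
    ∑ₛ (λ S → probOf p (outside ∷ S) * (X S + ∑ₛ (λ A → 0ℚ * h (inside ∷ A))))
      + ∑ₛ (λ S → probOf p (inside ∷ S) * (X S + Y S))
      ≡⟨ cong₂ _+_ (∑ₛ-cong (λ S → cong₂ _*_ (probOf-outside S) (cong (X S +_) no-inside-terms)))
                   (∑ₛ-cong (λ S → cong (_* (X S + Y S)) (probOf-inside S))) ⟩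
    ∑ₛ (λ S → ((1ℚ - p) * P S) * (X S + 0ℚ)) + ∑ₛ (λ S → (p * P S) * (X S + Y S))
      ≡⟨ sym (∑ₛ-+ {n} _ _) ⟩
    ∑ₛ (λ S → ((1ℚ - p) * P S) * (X S + 0ℚ) + (p * P S) * (X S + Y S))
      ≡⟨ ∑ₛ-cong (λ S → regroup p (P S) (X S) (Y S)) ⟩
    ∑ₛ (λ S → P S * X S + p * (P S * Y S))
      ≡⟨ trans (∑ₛ-+ {n} _ _) (cong (∑ₛ (λ S → P S * X S) +_) (∑ₛ-* {n} p _)) ⟩
    ∑ₛ (λ S → P S * X S) + p * ∑ₛ (λ S → P S * Y S)
      ≡⟨ cong₂ (λ a b → a + p * b) (∑ₛ-probOf-∑⊆ (λ A → h (outside ∷ A))) (∑ₛ-probOf-∑⊆ (λ A → h (inside ∷ A))) ⟩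
    ∑ₛ (λ A → p ^ℚ ∣ A ∣ * h (outside ∷ A)) + p * ∑ₛ (λ A → p ^ℚ ∣ A ∣ * h (inside ∷ A))
      ≡⟨ cong (∑ₛ (λ A → p ^ℚ ∣ A ∣ * h (outside ∷ A)) +_)
              (trans (sym (∑ₛ-* {n} p _)) (∑ₛ-cong (λ A → sym (ℚP.*-assoc p (p ^ℚ ∣ A ∣) (h (inside ∷ A)))))) ⟩
    ∑ₛ (λ A → p ^ℚ ∣ A ∣ * h A) ∎
    where
    open ≡-Reasoning
    open +-*-Solver
    P : Subset n → ℚ
    P = probOf p
    X Y : Subset n → ℚ
    X S = ∑ₛ (λ A → 𝟙 (A ⊆? S) * h (outside ∷ A))
    Y S = ∑ₛ (λ A → 𝟙 (A ⊆? S) * h (inside ∷ A))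
    no-inside-terms : ∑ₛ {n} (λ A → 0ℚ * h (inside ∷ A)) ≡ 0ℚ
    no-inside-terms = trans (∑ₛ-cong (λ A → ℚP.*-zeroˡ (h (inside ∷ A)))) (∑ₛ-0 {n})
    regroup : ∀ p P X Y → ((1ℚ - p) * P) * (X + 0ℚ) + (p * P) * (X + Y) ≡ P * X + p * (P * Y)
    regroup = solve 4 (λ p P X Y → ((con 1ℚ :- p) :* P) :* (X :+ con 0ℚ) :+ (p :* P) :* (X :+ Y)
                                   := P :* X :+ p :* (P :* Y)) refl

weight : ∀ {n} → (Fin n → ℚ) → Subset n → ℚ
weight {ℕ.zero}  u []            = 1ℚ
weight {ℕ.suc n} u (outside ∷ A) = weight (λ i → u (suc i)) A
weight {ℕ.suc n} u (inside ∷ A)  = u zero * weight (λ i → u (suc i)) A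

weight-cong : ∀ {n} {u v : Fin n → ℚ} → (∀ i → u i ≡ v i) → ∀ A → weight u A ≡ weight v A
weight-cong u≗v []            = refl
weight-cong u≗v (outside ∷ A) = weight-cong (λ i → u≗v (suc i)) A
weight-cong u≗v (inside ∷ A)  = cong₂ _*_ (u≗v zero) (weight-cong (λ i → u≗v (suc i)) A)

weight-const : ∀ {n} w (A : Subset n) → weight (λ _ → w) A ≡ w ^ℚ ∣ A ∣
weight-const w []            = refl
weight-const w (outside ∷ A) = weight-const w A
weight-const w (inside ∷ A)  = cong (w *_) (weight-const w A)

weight-++ : ∀ {m n} (u : Fin (m ℕ.+ n) → ℚ) (B : Subset m) (C : Subset n) →
            weight u (B ++ C) ≡ weight (λ i → u (i ↑ˡ n)) B * weight (λ j → u (m ↑ʳ j)) C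
weight-++ u []            C = sym (ℚP.*-identityˡ _)
weight-++ u (outside ∷ B) C = weight-++ (λ i → u (suc i)) B C
weight-++ u (inside ∷ B)  C =
  trans (cong (u zero *_) (weight-++ (λ i → u (suc i)) B C)) (sym (ℚP.*-assoc (u zero) _ _))

weight-restrict : ∀ {n} w (G B : Subset n) →
                  weight (λ i → if lookup G i then w else 0ℚ) B ≡ w ^ℚ ∣ B ∣ * 𝟙 (B ⊆? G)
weight-restrict w []            []            = refl
weight-restrict w (_ ∷ G)       (outside ∷ B) = weight-restrict w G B
weight-restrict w (inside ∷ G)  (inside ∷ B)  =
  trans (cong (w *_) (weight-restrict w G B)) (sym (ℚP.*-assoc w _ _))
weight-restrict w (outside ∷ G) (inside ∷ B)  =
  trans (ℚP.*-zeroˡ (weight (λ i → if lookup G i then w else 0ℚ) B)) (sym (ℚP.*-zeroʳ (w * w ^ℚ ∣ B ∣)))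

∑ₛ-weight-0 : ∀ {m} (h : Subset m → ℚ) → ∑ₛ (λ C → weight (λ _ → 0ℚ) C * h C) ≡ h ⊥
∑ₛ-weight-0 {ℕ.zero}  h = ℚP.*-identityˡ (h [])
∑ₛ-weight-0 {ℕ.suc m} h = begin
  ∑ₛ (λ C → weight (λ _ → 0ℚ) C * h (outside ∷ C)) + ∑ₛ (λ C → (0ℚ * weight (λ _ → 0ℚ) C) * h (inside ∷ C))
    ≡⟨ cong₂ _+_ (∑ₛ-weight-0 (λ C → h (outside ∷ C)))
                 (trans (∑ₛ-cong (λ C → trans (cong (_* h (inside ∷ C)) (ℚP.*-zeroˡ (weight (λ _ → 0ℚ) C))) (ℚP.*-zeroˡ (h (inside ∷ C))))) (∑ₛ-0 {m})) ⟩
  h ⊥ + 0ℚ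
    ≡⟨ ℚP.+-identityʳ (h ⊥) ⟩
  h ⊥ ∎
  where open ≡-Reasoning

-- A point of B ∪ C lies in B only, in C only or in both: weights a, b and ab, in total (1 + a)(1 + b) - 1.
∑ₛ-∪ : ∀ {m} (a b : Fin m → ℚ) (h : Subset m → ℚ) →
       ∑ₛ (λ B → ∑ₛ (λ C → (weight a B * weight b C) * h (B ∪ C))) ≡
       ∑ₛ (λ D → weight (λ v → (1ℚ + a v) * (1ℚ + b v) - 1ℚ) D * h D)
∑ₛ-∪ {ℕ.zero}  a b h = cong (_* h []) (ℚP.*-identityˡ 1ℚ)
∑ₛ-∪ {ℕ.suc m} a b h = begin
  ∑ₛ (λ B → ∑ₛ (H₀ B) + ∑ₛ (λ C → (wa B * (b₀ * wb C)) * h (inside ∷ (B ∪ C))))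
    + ∑ₛ (λ B → ∑ₛ (λ C → ((a₀ * wa B) * wb C) * h (inside ∷ (B ∪ C)))
                + ∑ₛ (λ C → ((a₀ * wa B) * (b₀ * wb C)) * h (inside ∷ (B ∪ C))))
    ≡⟨ cong₂ _+_ (∑ₛ-cong (λ B → cong (∑ₛ (H₀ B) +_) (pull b₀ (λ C → swap-out (wa B) b₀ (wb C) _))))
                 (∑ₛ-cong (λ B → cong₂ _+_ (pull a₀ (λ C → sym (assoc-out a₀ (wa B) (wb C) _)))
                                           (pull (a₀ * b₀) (λ C → swap-both a₀ (wa B) b₀ (wb C) _)))) ⟩
  ∑ₛ (λ B → ∑ₛ (H₀ B) + b₀ * ∑ₛ (H₁ B)) + ∑ₛ (λ B → a₀ * ∑ₛ (H₁ B) + (a₀ * b₀) * ∑ₛ (H₁ B))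
    ≡⟨ cong₂ _+_ (trans (∑ₛ-+ {m} _ _) (cong (X +_) (∑ₛ-* {m} b₀ _)))
                 (trans (∑ₛ-+ {m} _ _) (cong₂ _+_ (∑ₛ-* {m} a₀ _) (∑ₛ-* {m} (a₀ * b₀) _))) ⟩
  (X + b₀ * Y) + (a₀ * Y + (a₀ * b₀) * Y)
    ≡⟨ collect X Y a₀ b₀ ⟩
  X + c₀ * Y
    ≡⟨ cong₂ (λ s t → s + c₀ * t) (∑ₛ-∪ a′ b′ (λ D → h (outside ∷ D))) (∑ₛ-∪ a′ b′ (λ D → h (inside ∷ D))) ⟩
  ∑ₛ (λ D → weight c′ D * h (outside ∷ D)) + c₀ * ∑ₛ (λ D → weight c′ D * h (inside ∷ D))
    ≡⟨ cong (∑ₛ (λ D → weight c′ D * h (outside ∷ D)) +_)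
            (pull c₀ (λ D → sym (ℚP.*-assoc c₀ (weight c′ D) (h (inside ∷ D))))) ⟨
  ∑ₛ (λ D → weight (λ v → (1ℚ + a v) * (1ℚ + b v) - 1ℚ) D * h D) ∎
  where
  open ≡-Reasoning
  open +-*-Solver
  a₀ = a zero
  b₀ = b zero
  a′ b′ c′ : Fin m → ℚ
  a′ i = a (suc i)
  b′ i = b (suc i)
  c′ v = (1ℚ + a′ v) * (1ℚ + b′ v) - 1ℚ
  c₀ = (1ℚ + a₀) * (1ℚ + b₀) - 1ℚ
  wa wb : Subset m → ℚ
  wa = weight a′
  wb = weight b′
  H₀ H₁ : Subset m → Subset m → ℚ
  H₀ B C = (wa B * wb C) * h (outside ∷ (B ∪ C))
  H₁ B C = (wa B * wb C) * h (inside ∷ (B ∪ C))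
  X = ∑ₛ (λ B → ∑ₛ (H₀ B))
  Y = ∑ₛ (λ B → ∑ₛ (H₁ B))
  pull : ∀ c {f g : Subset m → ℚ} → (∀ C → c * f C ≡ g C) → ∑ₛ g ≡ c * ∑ₛ f
  pull c {f} cf≗g = trans (sym (∑ₛ-cong cf≗g)) (∑ₛ-* c f)
  assoc-out : ∀ x y z t → ((x * y) * z) * t ≡ x * ((y * z) * t)
  assoc-out = solve 4 (λ x y z t → ((x :* y) :* z) :* t := x :* ((y :* z) :* t)) refl
  swap-out : ∀ x y z t → y * ((x * z) * t) ≡ (x * (y * z)) * t
  swap-out = solve 4 (λ x y z t → y :* ((x :* z) :* t) := (x :* (y :* z)) :* t) refl
  swap-both : ∀ x y z t s → (x * z) * ((y * t) * s) ≡ ((x * y) * (z * t)) * s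
  swap-both = solve 5 (λ x y z t s → (x :* z) :* ((y :* t) :* s) := ((x :* y) :* (z :* t)) :* s) refl
  collect : ∀ X Y a b → (X + b * Y) + (a * Y + (a * b) * Y) ≡ X + ((1ℚ + a) * (1ℚ + b) - 1ℚ) * Y
  collect = solve 4 (λ X Y a b → (X :+ b :* Y) :+ (a :* Y :+ (a :* b) :* Y)
                                 := X :+ ((con 1ℚ :+ a) :* (con 1ℚ :+ b) :- con 1ℚ) :* Y) refl

↑ˡ∈++⁺ : ∀ {m n} {B : Subset m} {C : Subset n} {v} → v ∈ B → v ↑ˡ n ∈ B ++ C
↑ˡ∈++⁺ here      = here
↑ˡ∈++⁺ (there p) = there (↑ˡ∈++⁺ p)

↑ˡ∈++⁻ : ∀ {m n} (B : Subset m) {C : Subset n} {v} → v ↑ˡ n ∈ B ++ C → v ∈ B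
↑ˡ∈++⁻ (_ ∷ B) {v = zero}  here      = here
↑ˡ∈++⁻ (_ ∷ B) {v = suc v} (there p) = there (↑ˡ∈++⁻ B p)

↑ʳ∈++⁺ : ∀ {m n} (B : Subset m) {C : Subset n} {j} → j ∈ C → m ↑ʳ j ∈ B ++ C
↑ʳ∈++⁺ []      p = p
↑ʳ∈++⁺ (_ ∷ B) p = there (↑ʳ∈++⁺ B p)

↑ʳ∈++⁻ : ∀ {m n} (B : Subset m) {C : Subset n} {j} → m ↑ʳ j ∈ B ++ C → j ∈ C
↑ʳ∈++⁻ []      p         = p
↑ʳ∈++⁻ (_ ∷ B) (there p) = ↑ʳ∈++⁻ B p

take-++ : ∀ {m n} (B : Subset m) (C : Subset n) → take m (B ++ C) ≡ B
take-++ {m} B C = sym (VecP.++-injectiveˡ B (take m (B ++ C)) (proj₂ (proj₂ (splitAt m (B ++ C)))))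

drop-++ : ∀ {m n} (B : Subset m) (C : Subset n) → drop m (B ++ C) ≡ C
drop-++ {m} B C = sym (VecP.++-injectiveʳ B (take m (B ++ C)) (proj₂ (proj₂ (splitAt m (B ++ C)))))

-- Fin (k * m) is k blocks of m points, combine a v being point v of block a; collapse superimposes
-- the blocks.  For k = q and m = q^d it projects GF(q)^(d+1) onto the last d coordinates.
collapse : ∀ k {m} → Subset (k ℕ.* m) → Subset m
collapse ℕ.zero        B = ⊥
collapse (ℕ.suc k) {m} B = take m B ∪ collapse k (drop m B)

collapse-⁺ : ∀ k {m} (B : Subset (k ℕ.* m)) (a : Fin k) (v : Fin m) → combine a v ∈ B → v ∈ collapse k B
collapse-⁺ (ℕ.suc k) {m} B zero    v p =
  SubsetP.x∈p∪q⁺ (inj₁ (↑ˡ∈++⁻ (take m B) (subst (_ ∈_) (sym (VecP.take++drop≡id m B)) p)))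
collapse-⁺ (ℕ.suc k) {m} B (suc a) v p =
  SubsetP.x∈p∪q⁺ (inj₂ (collapse-⁺ k (drop m B) a v (↑ʳ∈++⁻ (take m B) (subst (_ ∈_) (sym (VecP.take++drop≡id m B)) p))))

collapse-⁻ : ∀ k {m} (B : Subset (k ℕ.* m)) (v : Fin m) → v ∈ collapse k B → ∃ λ (a : Fin k) → combine a v ∈ B
collapse-⁻ ℕ.zero        B v p = ⊥-elim (SubsetP.∉⊥ p)
collapse-⁻ (ℕ.suc k) {m} B v p with SubsetP.x∈p∪q⁻ (take m B) (collapse k (drop m B)) p
... | inj₁ p₁ = zero , subst (_ ∈_) (VecP.take++drop≡id m B) (↑ˡ∈++⁺ p₁)
... | inj₂ p₂ with collapse-⁻ k (drop m B) v p₂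
...   | a , q = suc a , subst (_ ∈_) (VecP.take++drop≡id m B) (↑ʳ∈++⁺ (take m B) q)

collapse-++ : ∀ k {m} (B : Subset m) (C : Subset (k ℕ.* m)) → collapse (ℕ.suc k) (B ++ C) ≡ B ∪ collapse k C
collapse-++ k B C = cong₂ (λ X Y → X ∪ collapse k Y) (take-++ B C) (drop-++ B C)

∏ : ∀ {k} → Vector ℚ k → ℚ
∏ = Vector.foldr _*_ 1ℚ

∏-const : ∀ k x → ∏ {k} (λ _ → x) ≡ x ^ℚ k
∏-const ℕ.zero    x = refl
∏-const (ℕ.suc k) x = cong (x *_) (∏-const k x)

∏-cong : ∀ {k} {f g : Fin k → ℚ} → (∀ a → f a ≡ g a) → ∏ f ≡ ∏ g
∏-cong {ℕ.zero}  f≗g = refl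
∏-cong {ℕ.suc k} f≗g = cong₂ _*_ (f≗g zero) (∏-cong (λ a → f≗g (suc a)))

∏-1 : ∀ k → ∏ {k} (λ _ → 1ℚ) ≡ 1ℚ
∏-1 ℕ.zero    = refl
∏-1 (ℕ.suc k) = trans (ℚP.*-identityˡ _) (∏-1 k)

∏-1+δ : ∀ {k} (t : Fin k) w → ∏ (λ a → 1ℚ + (if does (a Fin.≟ t) then w else 0ℚ)) ≡ 1ℚ + w
∏-1+δ {ℕ.suc k} zero    w =
  trans (cong ((1ℚ + w) *_) (trans (∏-cong {k} (λ _ → ℚP.+-identityʳ 1ℚ)) (∏-1 k))) (ℚP.*-identityʳ (1ℚ + w))
∏-1+δ {ℕ.suc k} (suc t) w = trans (cong₂ _*_ (ℚP.+-identityʳ 1ℚ) (∏-1+δ t w)) (ℚP.*-identityˡ (1ℚ + w))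

-- The total weight of the nonempty sets of copies of v, i.e. of the ways v gets into the collapse.
collapsedWeight : ∀ k {m} → (Fin (k ℕ.* m) → ℚ) → Fin m → ℚ
collapsedWeight k u v = ∏ {k} (λ a → 1ℚ + u (combine a v)) - 1ℚ

∑ₛ-collapse : ∀ k {m} (u : Fin (k ℕ.* m) → ℚ) (h : Subset m → ℚ) →
              ∑ₛ (λ B → weight u B * h (collapse k B)) ≡ ∑ₛ (λ C → weight (collapsedWeight k u) C * h C)
∑ₛ-collapse ℕ.zero        u h = trans (ℚP.*-identityˡ (h ⊥)) (sym (∑ₛ-weight-0 h))
∑ₛ-collapse (ℕ.suc k) {m} u h = begin
  ∑ₛ (λ B → weight u B * h (collapse (ℕ.suc k) B))
    ≡⟨ ∑ₛ-++ m {k ℕ.* m} _ ⟩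
  ∑ₛ {m} (λ B → ∑ₛ {k ℕ.* m} (λ C → weight u (B ++ C) * h (collapse (ℕ.suc k) (B ++ C))))
    ≡⟨ ∑ₛ-cong {m} (λ B → ∑ₛ-cong {k ℕ.* m} (λ C →
         cong₂ _*_ (weight-++ u B C) (cong h (collapse-++ k B C)))) ⟩
  ∑ₛ {m} (λ B → ∑ₛ {k ℕ.* m} (λ C → (weight u₀ B * weight u′ C) * h (B ∪ collapse k C)))
    ≡⟨ ∑ₛ-cong {m} (λ B → begin
         ∑ₛ (λ C → (weight u₀ B * weight u′ C) * h (B ∪ collapse k C))
           ≡⟨ ∑ₛ-*-assoc (weight u₀ B) (weight u′) (λ C → h (B ∪ collapse k C)) ⟩
         weight u₀ B * ∑ₛ (λ C → weight u′ C * h (B ∪ collapse k C))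
           ≡⟨ cong (weight u₀ B *_) (∑ₛ-collapse k u′ (λ C → h (B ∪ C))) ⟩
         weight u₀ B * ∑ₛ (λ C → weight w′ C * h (B ∪ C))
           ≡⟨ ∑ₛ-*-assoc (weight u₀ B) (weight w′) (λ C → h (B ∪ C)) ⟨
         ∑ₛ (λ C → (weight u₀ B * weight w′ C) * h (B ∪ C)) ∎) ⟩
  ∑ₛ {m} (λ B → ∑ₛ {m} (λ C → (weight u₀ B * weight w′ C) * h (B ∪ C)))
    ≡⟨ ∑ₛ-∪ u₀ w′ h ⟩
  ∑ₛ (λ D → weight (λ v → (1ℚ + u₀ v) * (1ℚ + w′ v) - 1ℚ) D * h D)
    ≡⟨ ∑ₛ-cong (λ D → cong (_* h D) (weight-cong (λ v → cancel (u₀ v) (∏ {k} (λ a → 1ℚ + u′ (combine a v)))) D)) ⟩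
  ∑ₛ (λ D → weight (collapsedWeight (ℕ.suc k) u) D * h D) ∎
  where
  open ≡-Reasoning
  open +-*-Solver
  u₀ : Fin m → ℚ
  u₀ v = u (v ↑ˡ k ℕ.* m)
  u′ : Fin (k ℕ.* m) → ℚ
  u′ i = u (m ↑ʳ i)
  w′ : Fin m → ℚ
  w′ = collapsedWeight k u′
  cancel : ∀ x P → (1ℚ + x) * (1ℚ + (P - 1ℚ)) - 1ℚ ≡ (1ℚ + x) * P - 1ℚ
  cancel = solve 2 (λ x P → (con 1ℚ :+ x) :* (con 1ℚ :+ (P :- con 1ℚ)) :- con 1ℚ
                            := (con 1ℚ :+ x) :* P :- con 1ℚ) refl

fromDec : ∀ {n} {P : Fin n → Set} → (∀ i → Dec (P i)) → Subset n
fromDec P? = Vec.tabulate (λ i → does (P? i))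

∈-fromDec⁺ : ∀ {n} {P : Fin n → Set} (P? : ∀ i → Dec (P i)) {i} → P i → i ∈ fromDec P?
∈-fromDec⁺ P? {i} p = VecP.lookup⇒[]= i _ (trans (VecP.lookup∘tabulate _ i) (dec-true (P? i) p))

∈-fromDec⁻ : ∀ {n} {P : Fin n → Set} (P? : ∀ i → Dec (P i)) {i} → i ∈ fromDec P? → P i
∈-fromDec⁻ P? {i} i∈ = true⇒P (P? i) (trans (sym (VecP.lookup∘tabulate _ i)) (VecP.[]=⇒lookup i∈))
  where
  true⇒P : ∀ {Q : Set} (Q? : Dec Q) → does Q? ≡ true → Q
  true⇒P (yes q) _ = q

module Spanning {q : ℕ} (F : FieldOn q) where
  open FieldOn F
  open IsCommutativeRing isCommRing
    using (zeroˡ; zeroʳ; +-identityˡ; +-identityʳ; *-identityʳ; *-comm; *-assoc; +-assoc; distribˡ; distribʳ; -‿inverseʳ)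

  𝔽 : CommutativeRing 0ℓ 0ℓ
  𝔽 = record { isCommutativeRing = isCommRing }

  open Algebra.Properties.Group (CommutativeRing.+-group 𝔽) using (x∙y⁻¹≈ε⇒x≈y)
  open Algebra.Properties.AbelianGroup (CommutativeRing.+-abelianGroup 𝔽) using (xyx⁻¹≈y)
  open Algebra.Properties.Ring (CommutativeRing.ring 𝔽) using (-1*x≈-x)

  open FinSum 𝔽 using (δ; δ-sym) renaming
    (sum to ∑; sum-cong-≗ to ∑-cong; sum-+ to ∑-+; *-distribˡ-sum to *-distribˡ-∑;
     sum-replicate-zero to ∑-0; sum-*δ to ∑-*δ)

  V : ℕ → Set
  V d = Fin d → Fin q

  point : ∀ d → Fin (q ℕ.^ d) → V d
  point = vecOf F

  ΣF≡∑ : ∀ d {n} (f : Fin n → Fin q) → ΣF F d f ≡ ∑ f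
  ΣF≡∑ d {ℕ.zero}  f = refl
  ΣF≡∑ d {ℕ.suc n} f = cong (f zero +F_) (ΣF≡∑ d (λ i → f (suc i)))

  point-injective : ∀ d {ℓ ℓ′} → (∀ k → point d ℓ k ≡ point d ℓ′ k) → ℓ ≡ ℓ′
  point-injective d {ℓ} {ℓ′} ℓ≗ℓ′ =
    trans (sym (FinP.funToFin-finToFin {d} {q} ℓ)) (trans (funToFin-cong ℓ≗ℓ′) (FinP.funToFin-finToFin {d} {q} ℓ′))
    where
    funToFin-cong : ∀ {n} {f g : Fin n → Fin q} → (∀ k → f k ≡ g k) → Fin.funToFin f ≡ Fin.funToFin g
    funToFin-cong {ℕ.zero}  f≗g = refl
    funToFin-cong {ℕ.suc n} f≗g = cong₂ combine (f≗g zero) (funToFin-cong (λ k → f≗g (suc k)))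

  -- span-≗ closes the span under pointwise equality, vectors being functions without funext.
  data InSpan d (A : Subset (q ℕ.^ d)) : V d → Set where
    span-0 : InSpan d A (λ _ → 0F)
    span-∈ : ∀ {i} → i ∈ A → InSpan d A (point d i)
    span-+ : ∀ {u v} → InSpan d A u → InSpan d A v → InSpan d A (λ j → u j +F v j)
    span-* : ∀ c {u} → InSpan d A u → InSpan d A (λ j → c *F u j)
    span-≗ : ∀ {u v} → (∀ j → u j ≡ v j) → InSpan d A u → InSpan d A v

  ∑-inSpan : ∀ d (A : Subset (q ℕ.^ d)) {n} (x : Fin n → V d) →
             (∀ k → InSpan d A (x k)) → InSpan d A (λ t → ∑ (λ k → x k t))
  ∑-inSpan d A {ℕ.zero}  x x∈ = span-0
  ∑-inSpan d A {ℕ.suc n} x x∈ = span-+ (x∈ zero) (∑-inSpan d A (λ k → x (suc k)) (λ k → x∈ (suc k)))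

  LinComb : ∀ d → Subset (q ℕ.^ d) → V d → Set
  LinComb d A v = ∃ λ (c : Fin (q ℕ.^ d) → Fin q) →
    (∀ i → i ∉ A → c i ≡ 0F) × (∀ j → ∑ (λ i → c i *F point d i j) ≡ v j)

  inSpan⇒linComb : ∀ {d A v} → InSpan d A v → LinComb d A v
  inSpan⇒linComb {d} span-0 =
    (λ _ → 0F) , (λ _ _ → refl) , (λ j → trans (∑-cong (λ i → zeroˡ (point d i j))) (∑-0 (q ℕ.^ d)))
  inSpan⇒linComb {d} {A} (span-∈ {i} i∈A) = (λ k → δ k i) , off-A , (λ j →
    trans (∑-cong (λ k → *-comm (δ k i) (point d k j))) (∑-*δ (λ k → point d k j) i))
    where
    off-A : ∀ k → k ∉ A → δ k i ≡ 0F
    off-A k k∉A with k Fin.≟ i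
    ... | yes refl = ⊥-elim (k∉A i∈A)
    ... | no _     = refl
  inSpan⇒linComb {d} (span-+ s t) with inSpan⇒linComb s | inSpan⇒linComb t
  ... | c , c-off , c-sum | c′ , c′-off , c′-sum =
    (λ i → c i +F c′ i) ,
    (λ i i∉A → trans (cong₂ _+F_ (c-off i i∉A) (c′-off i i∉A)) (+-identityˡ 0F)) ,
    (λ j → trans (∑-cong (λ i → distribʳ (point d i j) (c i) (c′ i)))
                 (trans (∑-+ (λ i → c i *F point d i j) (λ i → c′ i *F point d i j)) (cong₂ _+F_ (c-sum j) (c′-sum j))))
  inSpan⇒linComb {d} (span-* a s) with inSpan⇒linComb s
  ... | c , c-off , c-sum =
    (λ i → a *F c i) ,
    (λ i i∉A → trans (cong (a *F_) (c-off i i∉A)) (zeroʳ a)) ,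
    (λ j → trans (∑-cong (λ i → *-assoc a (c i) (point d i j)))
                 (trans (sym (*-distribˡ-∑ a (λ i → c i *F point d i j))) (cong (a *F_) (c-sum j))))
  inSpan⇒linComb (span-≗ u≗v s) with inSpan⇒linComb s
  ... | c , c-off , c-sum = c , c-off , (λ j → trans (c-sum j) (u≗v j))

  linComb⇒inSpan : ∀ {d A v} → LinComb d A v → InSpan d A v
  linComb⇒inSpan {d} {A} (c , c-off , c-sum) =
    span-≗ c-sum (∑-inSpan d A (λ i j → c i *F point d i j) term)
    where
    term : ∀ i → InSpan d A (λ j → c i *F point d i j)
    term i with i SubsetP.∈? A
    ... | yes i∈A = span-* (c i) (span-∈ i∈A)
    ... | no  i∉A = span-≗ (λ j → trans (sym (zeroˡ (point d i j))) (cong (_*F point d i j) (sym (c-off i i∉A)))) span-0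

  spans⇒inSpan : ∀ d (A : Subset (q ℕ.^ d)) → Spans F d A → ∀ v → InSpan d A v
  spans⇒inSpan d A A-spans v with A-spans (Vec.tabulate v)
  ... | c , c-off , c-sum = span-≗ (λ j → VecP.lookup∘tabulate v j) (linComb⇒inSpan
        (lookup c , c-off , (λ j → trans (sym (ΣF≡∑ d (λ i → lookup c i *F point d i j))) (c-sum j))))

  inSpan⇒spans : ∀ d (A : Subset (q ℕ.^ d)) → (∀ v → InSpan d A v) → Spans F d A
  inSpan⇒spans d A all-inSpan v with inSpan⇒linComb (all-inSpan (lookup v))
  ... | c , c-off , c-sum =
    Vec.tabulate c ,
    (λ i i∉A → trans (VecP.lookup∘tabulate c i) (c-off i i∉A)) ,
    (λ j → trans (ΣF≡∑ d (λ i → lookup (Vec.tabulate c) i *F point d i j)) (trans (∑-cong (λ i → cong (_*F point d i j) (VecP.lookup∘tabulate c i))) (c-sum j)))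

  infix 8 _·_
  _·_ : ∀ {d} → V d → V d → Fin q
  c · v = ∑ (λ j → c j *F v j)

  ·-cong : ∀ {d} (c : V d) {u v : V d} → (∀ j → u j ≡ v j) → c · u ≡ c · v
  ·-cong c u≗v = ∑-cong (λ j → cong (c j *F_) (u≗v j))

  ·-0 : ∀ {d} (c : V d) → c · (λ _ → 0F) ≡ 0F
  ·-0 {d} c = trans (∑-cong (λ j → zeroʳ (c j))) (∑-0 d)

  ·-+ : ∀ {d} (c u v : V d) → c · (λ j → u j +F v j) ≡ c · u +F c · v
  ·-+ c u v = trans (∑-cong (λ j → distribˡ (c j) (u j) (v j))) (∑-+ (λ j → c j *F u j) (λ j → c j *F v j))

  ·-* : ∀ {d} (c : V d) a (u : V d) → c · (λ j → a *F u j) ≡ a *F c · u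
  ·-* c a u = trans (∑-cong (λ j → swap (c j) (u j))) (sym (*-distribˡ-∑ a (λ j → c j *F u j)))
    where
    swap : ∀ x y → x *F (a *F y) ≡ a *F (x *F y)
    swap x y = trans (sym (*-assoc x a y)) (trans (cong (_*F y) (*-comm x a)) (*-assoc a x y))

  tail-inSpan : ∀ d (B : Subset (q ℕ.^ ℕ.suc d)) {x} →
                InSpan (ℕ.suc d) B x → InSpan d (collapse q B) (Vector.tail x)
  tail-inSpan d B span-0            = span-0
  tail-inSpan d B (span-∈ {i} i∈B)  = span-∈ (collapse-⁺ q B (quotient (q ℕ.^ d) i) (remainder {q} (q ℕ.^ d) i)
                                        (subst (_∈ B) (sym (FinP.combine-remQuot {q} (q ℕ.^ d) i)) i∈B))
  tail-inSpan d B (span-+ s t)      = span-+ (tail-inSpan d B s) (tail-inSpan d B t)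
  tail-inSpan d B (span-* a s)      = span-* a (tail-inSpan d B s)
  tail-inSpan d B (span-≗ u≗v s)    = span-≗ (λ j → u≗v (suc j)) (tail-inSpan d B s)

  spans-collapse : ∀ d (B : Subset (q ℕ.^ ℕ.suc d)) → Spans F (ℕ.suc d) B → Spans F d (collapse q B)
  spans-collapse d B B-spans = inSpan⇒spans d (collapse q B)
    (λ v → tail-inSpan d B (spans⇒inSpan (ℕ.suc d) B B-spans (0F ∷ᶠ v)))

  lift-inSpan : ∀ d (B : Subset (q ℕ.^ ℕ.suc d)) {v} →
                InSpan d (collapse q B) v → ∃ λ a → InSpan (ℕ.suc d) B (a ∷ᶠ v)
  lift-inSpan d B span-0 = 0F , span-≗ (λ { zero → refl ; (suc j) → refl }) span-0
  lift-inSpan d B (span-∈ {u} u∈C) with collapse-⁻ q B u u∈C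
  ... | a , i∈B = quotient (q ℕ.^ d) (combine a u) ,
    span-≗ (λ { zero → refl ; (suc j) → cong (λ w → point d (proj₂ w) j) (FinP.remQuot-combine a u) }) (span-∈ i∈B)
  lift-inSpan d B (span-+ s t) with lift-inSpan d B s | lift-inSpan d B t
  ... | a , s′ | b , t′ = a +F b , span-≗ (λ { zero → refl ; (suc j) → refl }) (span-+ s′ t′)
  lift-inSpan d B (span-* c s) with lift-inSpan d B s
  ... | a , s′ = c *F a , span-≗ (λ { zero → refl ; (suc j) → refl }) (span-* c s′)
  lift-inSpan d B (span-≗ u≗v s) with lift-inSpan d B s
  ... | a , s′ = a , span-≗ (λ { zero → refl ; (suc j) → u≗v j }) s′

  onGraph? : ∀ {d} (c : V d) (x : V (ℕ.suc d)) → Dec (x zero ≡ c · Vector.tail x)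
  onGraph? c x = x zero Fin.≟ c · Vector.tail x

  graph : ∀ d → V d → Subset (q ℕ.^ ℕ.suc d)
  graph d c = fromDec (λ i → onGraph? c (point (ℕ.suc d) i))

  graph-≗ : ∀ d {c c′ : V d} (B : Subset (q ℕ.^ ℕ.suc d)) → (∀ k → c k ≡ c′ k) → B ⊆ graph d c → B ⊆ graph d c′
  graph-≗ d {c} {c′} B c≗c′ B⊆G i∈B =
    ∈-fromDec⁺ (λ i → onGraph? c′ (point (ℕ.suc d) i))
      (trans (∈-fromDec⁻ (λ i → onGraph? c (point (ℕ.suc d) i)) (B⊆G i∈B))
             (∑-cong (λ j → cong (_*F _) (c≗c′ j))))

  graph-inSpan : ∀ d (c : V d) (B : Subset (q ℕ.^ ℕ.suc d)) → B ⊆ graph d c →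
                 ∀ {x} → InSpan (ℕ.suc d) B x → x zero ≡ c · Vector.tail x
  graph-inSpan d c B B⊆G span-0              = sym (·-0 c)
  graph-inSpan d c B B⊆G (span-∈ i∈B)        = ∈-fromDec⁻ (λ i → onGraph? c (point (ℕ.suc d) i)) (B⊆G i∈B)
  graph-inSpan d c B B⊆G (span-+ {u} {v} s t) =
    trans (cong₂ _+F_ (graph-inSpan d c B B⊆G s) (graph-inSpan d c B B⊆G t)) (sym (·-+ c (Vector.tail u) (Vector.tail v)))
  graph-inSpan d c B B⊆G (span-* a {u} s)    =
    trans (cong (a *F_) (graph-inSpan d c B B⊆G s)) (sym (·-* c a (Vector.tail u)))
  graph-inSpan d c B B⊆G (span-≗ u≗v s)      =
    trans (sym (u≗v zero)) (trans (graph-inSpan d c B B⊆G s) (·-cong c (λ j → u≗v (suc j))))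

  graph⇒¬spans : ∀ d (c : V d) (B : Subset (q ℕ.^ ℕ.suc d)) → B ⊆ graph d c → ¬ Spans F (ℕ.suc d) B
  graph⇒¬spans d c B B⊆G B-spans = 0≢1 (sym (trans
    (graph-inSpan d c B B⊆G (spans⇒inSpan (ℕ.suc d) B B-spans (1F ∷ᶠ (λ _ → 0F)))) (·-0 c)))

  graph-unique : ∀ d (B : Subset (q ℕ.^ ℕ.suc d)) (c c′ : V d) → Spans F d (collapse q B) →
                 B ⊆ graph d c → B ⊆ graph d c′ → ∀ k → c k ≡ c′ k
  graph-unique d B c c′ C-spans B⊆G B⊆G′ k with lift-inSpan d B (spans⇒inSpan d (collapse q B) C-spans (λ t → δ t k))
  ... | a , s = begin
    c k                   ≡⟨ ∑-*δ c k ⟨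
    c · (λ t → δ t k)     ≡⟨ graph-inSpan d c B B⊆G s ⟨
    a                     ≡⟨ graph-inSpan d c′ B B⊆G′ s ⟩
    c′ · (λ t → δ t k)    ≡⟨ ∑-*δ c′ k ⟩
    c′ k                  ∎
    where open ≡-Reasoning

  -- If the collapse spans, the lifts of the unit vectors single out a linear form c such
  -- that (c · v , v) lies in the span for every v.  A point of B off the graph of c would
  -- then put (1, 0) and hence everything in the span.
  ¬spans⇒graph : ∀ d (B : Subset (q ℕ.^ ℕ.suc d)) → Spans F d (collapse q B) →
                 ¬ Spans F (ℕ.suc d) B → ∃ λ c → B ⊆ graph d c
  ¬spans⇒graph d B C-spans ¬B-spans = c , λ i∈B → ∈-fromDec⁺ (λ i → onGraph? c (point (ℕ.suc d) i)) (on-graph i∈B)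
    where
    lift : ∀ v → ∃ λ a → InSpan (ℕ.suc d) B (a ∷ᶠ v)
    lift v = lift-inSpan d B (spans⇒inSpan d (collapse q B) C-spans v)

    c : V d
    c k = proj₁ (lift (λ t → δ t k))

    graph-point : ∀ v → InSpan (ℕ.suc d) B (c · v ∷ᶠ v)
    graph-point v = span-≗ coords
      (∑-inSpan (ℕ.suc d) B (λ k t → v k *F (c k ∷ᶠ (λ t → δ t k)) t) (λ k → span-* (v k) (proj₂ (lift (λ t → δ t k)))))
      where
      coords : ∀ t → ∑ (λ k → v k *F (c k ∷ᶠ (λ t → δ t k)) t) ≡ (c · v ∷ᶠ v) t
      coords zero    = ∑-cong (λ k → *-comm (v k) (c k))
      coords (suc t) = trans (∑-cong (λ k → cong (v k *F_) (δ-sym t k))) (∑-*δ v t)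

    e₀ : V (ℕ.suc d)
    e₀ = 1F ∷ᶠ (λ _ → 0F)

    off-graph⇒e₀ : ∀ {i} → i ∈ B → point (ℕ.suc d) i zero ≢ c · point d (remainder {q} (q ℕ.^ d) i) →
                   InSpan (ℕ.suc d) B e₀
    off-graph⇒e₀ {i} i∈B off =
      span-≗ coords (span-* y (span-+ (span-∈ i∈B) (span-* (-F 1F) (graph-point u))))
      where
      b = point (ℕ.suc d) i zero
      u = point d (remainder {q} (q ℕ.^ d) i)
      z = b +F -F (c · u)
      z≢0 : z ≢ 0F
      z≢0 z≡0 = off (x∙y⁻¹≈ε⇒x≈y b (c · u) z≡0)
      y = proj₁ (inverse z z≢0)
      coords : ∀ j → y *F (point (ℕ.suc d) i j +F -F 1F *F (c · u ∷ᶠ u) j) ≡ e₀ j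
      coords zero    = trans (cong (λ w → y *F (b +F w)) (-1*x≈-x (c · u))) (trans (*-comm y z) (proj₂ (inverse z z≢0)))
      coords (suc j) = trans (cong (λ w → y *F (u j +F w)) (-1*x≈-x (u j))) (trans (cong (y *F_) (-‿inverseʳ (u j))) (zeroʳ y))

    e₀⇒spans : InSpan (ℕ.suc d) B e₀ → ∀ x → InSpan (ℕ.suc d) B x
    e₀⇒spans e₀∈ x = span-≗ coords (span-+ (graph-point (Vector.tail x)) (span-* (x zero +F -F t) e₀∈))
      where
      t = c · Vector.tail x
      coords : ∀ j → (t ∷ᶠ Vector.tail x) j +F (x zero +F -F t) *F e₀ j ≡ x j
      coords zero    = trans (cong (t +F_) (*-identityʳ _)) (trans (sym (+-assoc t (x zero) (-F t))) (xyx⁻¹≈y t (x zero)))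
      coords (suc j) = trans (cong (x (suc j) +F_) (zeroʳ _)) (+-identityʳ (x (suc j)))

    on-graph : ∀ {i} → i ∈ B → point (ℕ.suc d) i zero ≡ c · point d (remainder {q} (q ℕ.^ d) i)
    on-graph {i} i∈B with onGraph? c (point (ℕ.suc d) i)
    ... | yes on = on
    ... | no off = ⊥-elim (¬B-spans (inSpan⇒spans (ℕ.suc d) B (e₀⇒spans (off-graph⇒e₀ i∈B off))))

module Counting {q : ℕ} (F : FieldOn q) where
  open FieldOn F using (0F)
  open Spanning F

  -- B spans iff its collapse spans and B lies on no graph; once the collapse spans, B lies on at
  -- most one graph.
  𝟙-spans-suc : ∀ d (B : Subset (q ℕ.^ ℕ.suc d)) →
                𝟙 (Spans? F (ℕ.suc d) B) ≡
                𝟙 (Spans? F d (collapse q B)) - sum (λ ℓ → 𝟙 (B ⊆? graph d (point d ℓ)) * 𝟙 (Spans? F d (collapse q B)))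
  𝟙-spans-suc d B = by-cases (Spans? F (ℕ.suc d) B) (Spans? F d (collapse q B))
    where
    on-graph? : ∀ ℓ → Dec (B ⊆ graph d (point d ℓ))
    on-graph? ℓ = B ⊆? graph d (point d ℓ)

    no-terms : ∀ (f : Fin (q ℕ.^ d) → ℚ) → sum (λ ℓ → f ℓ * 0ℚ) ≡ 0ℚ
    no-terms f = trans (sum-cong-≗ (λ ℓ → ℚP.*-zeroʳ (f ℓ))) (sum-replicate-zero (q ℕ.^ d))

    by-cases : (S? : Dec (Spans F (ℕ.suc d) B)) (C? : Dec (Spans F d (collapse q B))) →
               𝟙 S? ≡ 𝟙 C? - sum (λ ℓ → 𝟙 (on-graph? ℓ) * 𝟙 C?)
    by-cases (yes S) C? = sym (begin
      𝟙 C? - sum (λ ℓ → 𝟙 (on-graph? ℓ) * 𝟙 C?)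
        ≡⟨ cong₂ (λ x y → x - y) C≡1 (trans (sum-cong-≗ (λ ℓ → cong₂ _*_ (off-graph ℓ) C≡1)) (no-terms (λ _ → 0ℚ))) ⟩
      1ℚ - 0ℚ
        ≡⟨⟩
      1ℚ ∎)
      where
      open ≡-Reasoning
      C≡1 : 𝟙 C? ≡ 1ℚ
      C≡1 = 𝟙-yes C? (spans-collapse d B S)
      off-graph : ∀ ℓ → 𝟙 (on-graph? ℓ) ≡ 0ℚ
      off-graph ℓ = 𝟙-no (on-graph? ℓ) (λ B⊆G → graph⇒¬spans d (point d ℓ) B B⊆G S)
    by-cases (no _) (no _) = sym (cong (λ x → 0ℚ - x) (no-terms (λ ℓ → 𝟙 (on-graph? ℓ))))
    by-cases (no ¬S) (yes C) with ¬spans⇒graph d B C ¬S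
    ... | c , B⊆G = sym (begin
      1ℚ - sum (λ ℓ → 𝟙 (on-graph? ℓ) * 1ℚ)
        ≡⟨ cong (λ x → 1ℚ - x) (sum-cong-≗ (λ ℓ → trans (ℚP.*-identityʳ _) (trans (only-ℓ₀ ℓ) (sym (ℚP.*-identityˡ _))))) ⟩
      1ℚ - sum (λ ℓ → 1ℚ * 𝟙 (ℓ Fin.≟ ℓ₀))
        ≡⟨ cong (λ x → 1ℚ - x) (sum-*δ (λ _ → 1ℚ) ℓ₀) ⟩
      1ℚ - 1ℚ
        ≡⟨⟩
      0ℚ ∎)
      where
      open ≡-Reasoning
      ℓ₀ : Fin (q ℕ.^ d)
      ℓ₀ = Fin.funToFin c
      c≗ℓ₀ : ∀ k → c k ≡ point d ℓ₀ k
      c≗ℓ₀ k = sym (FinP.finToFun-funToFin c k)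
      only-ℓ₀ : ∀ ℓ → 𝟙 (on-graph? ℓ) ≡ 𝟙 (ℓ Fin.≟ ℓ₀)
      only-ℓ₀ ℓ = 𝟙-⇔ (on-graph? ℓ) (ℓ Fin.≟ ℓ₀)
        (λ B⊆Gℓ → point-injective d (graph-unique d B (point d ℓ) (point d ℓ₀) C B⊆Gℓ (graph-≗ d B c≗ℓ₀ B⊆G)))
        (λ { refl → graph-≗ d B c≗ℓ₀ B⊆G })

  spanWeight : ℕ → ℚ → ℚ
  spanWeight d w = ∑ₛ (λ A → w ^ℚ ∣ A ∣ * 𝟙 (Spans? F d A))

  spanWeight-zero : ∀ w → spanWeight 0 w ≡ 1ℚ + w
  spanWeight-zero w = begin
    1ℚ * 𝟙 (Spans? F 0 (outside ∷ [])) + (w * 1ℚ) * 𝟙 (Spans? F 0 (inside ∷ []))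
      ≡⟨ cong₂ (λ x y → 1ℚ * x + (w * 1ℚ) * y) (𝟙-yes (Spans? F 0 (outside ∷ [])) (everything-spans _)) (𝟙-yes (Spans? F 0 (inside ∷ [])) (everything-spans _)) ⟩
    1ℚ * 1ℚ + (w * 1ℚ) * 1ℚ
      ≡⟨ cong (1ℚ +_) (trans (ℚP.*-identityʳ _) (ℚP.*-identityʳ w)) ⟩
    1ℚ + w ∎
    where
    open ≡-Reasoning
    everything-spans : ∀ A → Spans F 0 A
    everything-spans A v = 0F ∷ [] , (λ { zero _ → refl }) , (λ ())

  spanWeight-collapse : ∀ d w →
    ∑ₛ (λ B → w ^ℚ ∣ B ∣ * 𝟙 (Spans? F d (collapse q B))) ≡ spanWeight d ((1ℚ + w) ^ℚ q - 1ℚ)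
  spanWeight-collapse d w = begin
    ∑ₛ (λ B → w ^ℚ ∣ B ∣ * I (collapse q B))
      ≡⟨ ∑ₛ-cong (λ B → cong (_* I (collapse q B)) (weight-const w B)) ⟨
    ∑ₛ (λ B → weight (λ _ → w) B * I (collapse q B))
      ≡⟨ ∑ₛ-collapse q (λ _ → w) I ⟩
    ∑ₛ (λ C → weight (collapsedWeight q (λ _ → w)) C * I C)
      ≡⟨ ∑ₛ-cong (λ C → cong (_* I C) (trans (weight-cong (λ _ → cong (_- 1ℚ) (∏-const q (1ℚ + w))) C)
                                              (weight-const ((1ℚ + w) ^ℚ q - 1ℚ) C))) ⟩
    spanWeight d ((1ℚ + w) ^ℚ q - 1ℚ) ∎
    where
    open ≡-Reasoning
    I : Subset (q ℕ.^ d) → ℚ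
    I C = 𝟙 (Spans? F d C)

  spanWeight-graph : ∀ d w ℓ →
    ∑ₛ (λ B → w ^ℚ ∣ B ∣ * (𝟙 (B ⊆? graph d (point d ℓ)) * 𝟙 (Spans? F d (collapse q B)))) ≡ spanWeight d w
  spanWeight-graph d w ℓ = begin
    ∑ₛ (λ B → w ^ℚ ∣ B ∣ * (𝟙 (B ⊆? Γ) * I (collapse q B)))
      ≡⟨ ∑ₛ-cong (λ B → trans (cong (_* I (collapse q B)) (weight-restrict w Γ B))
                              (ℚP.*-assoc (w ^ℚ ∣ B ∣) (𝟙 (B ⊆? Γ)) (I (collapse q B)))) ⟨
    ∑ₛ (λ B → weight u B * I (collapse q B))
      ≡⟨ ∑ₛ-collapse q u I ⟩
    ∑ₛ (λ C → weight (collapsedWeight q u) C * I C)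
      ≡⟨ ∑ₛ-cong (λ C → cong (_* I C) (trans (weight-cong one-lift C) (weight-const w C))) ⟩
    spanWeight d w ∎
    where
    open ≡-Reasoning
    open +-*-Solver
    I : Subset (q ℕ.^ d) → ℚ
    I C = 𝟙 (Spans? F d C)
    Γ = graph d (point d ℓ)
    u : Fin (q ℕ.^ ℕ.suc d) → ℚ
    u i = if lookup Γ i then w else 0ℚ
    one-lift : ∀ v → collapsedWeight q u v ≡ w
    one-lift v = begin
      ∏ {q} (λ a → 1ℚ + u (combine a v)) - 1ℚ
        ≡⟨ cong (_- 1ℚ) (∏-cong {q} (λ a → cong (λ b → 1ℚ + (if b then w else 0ℚ)) (block a))) ⟩
      ∏ (λ a → 1ℚ + (if does (a Fin.≟ point d ℓ · point d v) then w else 0ℚ)) - 1ℚ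
        ≡⟨ cong (_- 1ℚ) (∏-1+δ (point d ℓ · point d v) w) ⟩
      (1ℚ + w) - 1ℚ
        ≡⟨ solve 1 (λ w → (con 1ℚ :+ w) :- con 1ℚ := w) refl w ⟩
      w ∎
      where
      block : ∀ (a : Fin q) → lookup Γ (combine a v) ≡ does (a Fin.≟ point d ℓ · point d v)
      block a = trans (VecP.lookup∘tabulate _ (combine a v))
        (cong (λ (b , r) → does (b Fin.≟ point d ℓ · point d r)) (FinP.remQuot-combine a v))

  spanWeight-suc : ∀ d w → spanWeight (ℕ.suc d) w ≡ spanWeight d ((1ℚ + w) ^ℚ q - 1ℚ) - ℕ→ℚ (q ℕ.^ d) * spanWeight d w
  spanWeight-suc d w = begin
    ∑ₛ (λ B → w ^ℚ ∣ B ∣ * 𝟙 (Spans? F (ℕ.suc d) B))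
      ≡⟨ ∑ₛ-cong (λ B → trans (cong (w ^ℚ ∣ B ∣ *_) (𝟙-spans-suc d B)) (distrib (w ^ℚ ∣ B ∣) (X B) _)) ⟩
    ∑ₛ (λ B → w ^ℚ ∣ B ∣ * X B - sum (λ ℓ → w ^ℚ ∣ B ∣ * (G ℓ B * X B)))
      ≡⟨ trans (∑ₛ-- {q ℕ.^ ℕ.suc d} _ _) (cong (λ x → ∑ₛ (λ B → w ^ℚ ∣ B ∣ * X B) - x) (∑ₛ-sum-comm (λ ℓ B → w ^ℚ ∣ B ∣ * (G ℓ B * X B)))) ⟩
    ∑ₛ (λ B → w ^ℚ ∣ B ∣ * X B) - sum (λ ℓ → ∑ₛ (λ B → w ^ℚ ∣ B ∣ * (G ℓ B * X B)))
      ≡⟨ cong₂ _-_ (spanWeight-collapse d w) (trans (sum-cong-≗ (spanWeight-graph d w)) (sum-const (q ℕ.^ d) (spanWeight d w))) ⟩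
    spanWeight d ((1ℚ + w) ^ℚ q - 1ℚ) - ℕ→ℚ (q ℕ.^ d) * spanWeight d w ∎
    where
    open ≡-Reasoning
    X : Subset (q ℕ.^ ℕ.suc d) → ℚ
    X B = 𝟙 (Spans? F d (collapse q B))
    G : Fin (q ℕ.^ d) → Subset (q ℕ.^ ℕ.suc d) → ℚ
    G ℓ B = 𝟙 (B ⊆? graph d (point d ℓ))
    distrib : ∀ a x (f : Fin (q ℕ.^ d) → ℚ) → a * (x - sum f) ≡ a * x - sum (λ ℓ → a * f ℓ)
    distrib a x f = trans (x[y-z]≈xy-xz a x (sum f)) (cong (λ y → a * x - y) (*-distribˡ-sum a f))

  expectedSpanning≡spanWeight : ∀ d p → expectedSpanning F d p ≡ spanWeight d p
  expectedSpanning≡spanWeight d p = begin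
    expectedSpanning F d p
      ≡⟨ sumℚ-allSubsets (q ℕ.^ d) (λ S → probOf p S * ℕ→ℚ (spanningCount F d S)) ⟩
    ∑ₛ (λ S → probOf p S * ℕ→ℚ (spanningCount F d S))
      ≡⟨ ∑ₛ-cong (λ S → cong (probOf p S *_) (count≡∑ₛ S)) ⟩
    ∑ₛ (λ S → probOf p S * ∑ₛ (λ A → 𝟙 (A ⊆? S) * 𝟙 (Spans? F d A)))
      ≡⟨ ∑ₛ-probOf-∑⊆ p (λ A → 𝟙 (Spans? F d A)) ⟩
    spanWeight d p ∎
    where
    open ≡-Reasoning
    count≡∑ₛ : ∀ S → ℕ→ℚ (spanningCount F d S) ≡ ∑ₛ (λ A → 𝟙 (A ⊆? S) * 𝟙 (Spans? F d A))
    count≡∑ₛ S = begin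
      ℕ→ℚ (spanningCount F d S)
        ≡⟨ length-filter (λ A → (A ⊆? S) ×-dec Spans? F d A) (allSubsets (q ℕ.^ d)) ⟩
      sumℚ (List.map (λ A → 𝟙 ((A ⊆? S) ×-dec Spans? F d A)) (allSubsets (q ℕ.^ d)))
        ≡⟨ sumℚ-allSubsets (q ℕ.^ d) _ ⟩
      ∑ₛ (λ A → 𝟙 ((A ⊆? S) ×-dec Spans? F d A))
        ≡⟨ ∑ₛ-cong (λ A → 𝟙-× (A ⊆? S) (Spans? F d A)) ⟩
      ∑ₛ (λ A → 𝟙 (A ⊆? S) * 𝟙 (Spans? F d A)) ∎

Σ≤≡sum : ∀ d (f : ℕ → ℚ) → Σ≤ d f ≡ sum {ℕ.suc d} (λ k → f (toℕ k))
Σ≤≡sum ℕ.zero    f = sym (ℚP.+-identityʳ (f 0))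
Σ≤≡sum (ℕ.suc d) f = begin
  Σ≤ d f + f (ℕ.suc d)
    ≡⟨ cong₂ _+_ (Σ≤≡sum d f) (cong f (sym (FinP.toℕ-fromℕ (ℕ.suc d)))) ⟩
  sum {ℕ.suc d} (λ k → f (toℕ k)) + f (toℕ (Fin.fromℕ (ℕ.suc d)))
    ≡⟨ cong (_+ f (toℕ (Fin.fromℕ (ℕ.suc d)))) (sum-cong-≗ {ℕ.suc d} (λ k → cong f (FinP.toℕ-inject₁ k))) ⟨
  sum {ℕ.suc d} (λ k → f (toℕ (Fin.inject₁ k))) + f (toℕ (Fin.fromℕ (ℕ.suc d)))
    ≡⟨ sum-init-last (λ k → f (toℕ k)) ⟨
  sum {ℕ.suc (ℕ.suc d)} (λ k → f (toℕ k)) ∎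
  where open ≡-Reasoning

C2-suc : ∀ k → ℕ.suc k choose 2 ≡ k choose 2 ℕ.+ k
C2-suc k = trans (sym (nCk+nC[k+1]≡[n+1]C[k+1] k 1)) (trans (cong (ℕ._+ k choose 2) (nC1≡n k)) (ℕP.+-comm k (k choose 2)))

div-unique : ∀ a b c → b ≢ 0ℚ → c * b ≡ a → a div b ≡ c
div-unique a b c b≢0 c*b≡a with b ≟ℚ 0ℚ
... | yes b≡0 = ⊥-elim (b≢0 b≡0)
... | no b≢0′ = begin
  a * b⁻¹         ≡⟨ cong (_* b⁻¹) (sym c*b≡a) ⟩
  (c * b) * b⁻¹   ≡⟨ ℚP.*-assoc c b b⁻¹ ⟩
  c * (b * b⁻¹)   ≡⟨ cong (c *_) (ℚP.*-inverseʳ b {{≢-nonZero b≢0′}}) ⟩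
  c * 1ℚ          ≡⟨ ℚP.*-identityʳ c ⟩
  c               ∎
  where
  open ≡-Reasoning
  b⁻¹ = 1/_ b {{≢-nonZero b≢0′}}

module GaussianBinomial (q : ℕ) (1<q : 1 ℕ.< q) where

  [_]! : ℕ → ℚ
  [_]! = qFact q

  gauss : ℕ → ℕ → ℚ
  gauss d         ℕ.zero    = 1ℚ
  gauss ℕ.zero    (ℕ.suc k) = 0ℚ
  gauss (ℕ.suc d) (ℕ.suc k) = gauss d (ℕ.suc k) + ℕ→ℚ (q ℕ.^ (d ℕ.∸ k)) * gauss d k

  gauss-above : ∀ d k → d ℕ.< k → gauss d k ≡ 0ℚ
  gauss-above ℕ.zero    (ℕ.suc k) _           = refl
  gauss-above (ℕ.suc d) (ℕ.suc k) (ℕ.s≤s d<k) = begin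
    gauss d (ℕ.suc k) + ℕ→ℚ (q ℕ.^ (d ℕ.∸ k)) * gauss d k
      ≡⟨ cong₂ (λ x y → x + ℕ→ℚ (q ℕ.^ (d ℕ.∸ k)) * y) (gauss-above d (ℕ.suc k) (ℕP.m<n⇒m<1+n d<k)) (gauss-above d k d<k) ⟩
    0ℚ + ℕ→ℚ (q ℕ.^ (d ℕ.∸ k)) * 0ℚ
      ≡⟨ trans (ℚP.+-identityˡ _) (ℚP.*-zeroʳ (ℕ→ℚ (q ℕ.^ (d ℕ.∸ k)))) ⟩
    0ℚ ∎
    where open ≡-Reasoning

  gauss-diag : ∀ d → gauss d d ≡ 1ℚ
  gauss-diag ℕ.zero    = refl
  gauss-diag (ℕ.suc d) = begin
    gauss d (ℕ.suc d) + ℕ→ℚ (q ℕ.^ (d ℕ.∸ d)) * gauss d d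
      ≡⟨ cong₃ (gauss-above d (ℕ.suc d) (ℕP.n<1+n d)) (cong (λ e → ℕ→ℚ (q ℕ.^ e)) (ℕP.n∸n≡0 d)) (gauss-diag d) ⟩
    0ℚ + ℕ→ℚ 1 * 1ℚ
      ≡⟨⟩
    1ℚ ∎
    where
    open ≡-Reasoning
    cong₃ : ∀ {a a′ b b′ c c′} → a ≡ a′ → b ≡ b′ → c ≡ c′ → a + b * c ≡ a′ + b′ * c′
    cong₃ refl refl refl = refl

  1-q^suc≢0 : ∀ n → 1ℚ - ℕ→ℚ q ^ℚ ℕ.suc n ≢ 0ℚ
  1-q^suc≢0 n 1-qⁿ⁺¹≡0 = ℕP.<⇒≢ (ℕP.^-monoʳ-< q 1<q {0} {ℕ.suc n} (ℕ.s≤s ℕ.z≤n)) (sym (ℕ→ℚ-injective (begin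
    ℕ→ℚ (q ℕ.^ ℕ.suc n)          ≡⟨ ℕ→ℚ-^ q (ℕ.suc n) ⟩
    ℕ→ℚ q ^ℚ ℕ.suc n             ≡⟨ solve 1 (λ x → x := con 1ℚ :- (con 1ℚ :- x)) refl _ ⟩
    1ℚ - (1ℚ - ℕ→ℚ q ^ℚ ℕ.suc n) ≡⟨ cong (λ x → 1ℚ - x) 1-qⁿ⁺¹≡0 ⟩
    1ℚ                           ∎)))
    where
    open ≡-Reasoning
    open +-*-Solver

  [_]!≢0 : ∀ n → [ n ]! ≢ 0ℚ
  [ ℕ.zero  ]!≢0 ()
  [ ℕ.suc n ]!≢0 = x#0y#0→xy#0 ([ n ]!≢0) (1-q^suc≢0 n)

  -- The q-Pascal step, with x = q^(k+1), y = q^(d-k), a = [k]!, b = [d-k-1]!.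
  private
    pascal-step : ∀ (g g′ a b x y D : ℚ) → g * ((a * (1ℚ - x)) * b) ≡ D → g′ * (a * (b * (1ℚ - y))) ≡ D →
                  (g + y * g′) * ((a * (1ℚ - x)) * (b * (1ℚ - y))) ≡ D * (1ℚ - y * x)
    pascal-step g g′ a b x y D e e′ = begin
      (g + y * g′) * ((a * (1ℚ - x)) * (b * (1ℚ - y)))
        ≡⟨ solve 7 (λ g g′ a b x y D → (g :+ y :* g′) :* ((a :* (con 1ℚ :- x)) :* (b :* (con 1ℚ :- y)))
                    := (g :* ((a :* (con 1ℚ :- x)) :* b)) :* (con 1ℚ :- y) :+ (g′ :* (a :* (b :* (con 1ℚ :- y)))) :* (y :* (con 1ℚ :- x)))
                    refl g g′ a b x y D ⟩
      (g * ((a * (1ℚ - x)) * b)) * (1ℚ - y) + (g′ * (a * (b * (1ℚ - y)))) * (y * (1ℚ - x))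
        ≡⟨ cong₂ (λ u v → u * (1ℚ - y) + v * (y * (1ℚ - x))) e e′ ⟩
      D * (1ℚ - y) + D * (y * (1ℚ - x))
        ≡⟨ solve 3 (λ D x y → D :* (con 1ℚ :- y) :+ D :* (y :* (con 1ℚ :- x)) := D :* (con 1ℚ :- y :* x)) refl D x y ⟩
      D * (1ℚ - y * x) ∎
      where
      open ≡-Reasoning
      open +-*-Solver

  gauss-qFact : ∀ d k → k ℕ.≤ d → gauss d k * ([ k ]! * [ d ℕ.∸ k ]!) ≡ [ d ]!
  gauss-qFact d ℕ.zero _ = trans (ℚP.*-identityˡ _) (ℚP.*-identityˡ [ d ]!)
  gauss-qFact (ℕ.suc d) (ℕ.suc k) (ℕ.s≤s k≤d) with ℕP.m≤n⇒m<n∨m≡n k≤d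
  ... | inj₂ refl = trans (cong₂ (λ g f → g * ([ ℕ.suc k ]! * [ f ]!)) (gauss-diag (ℕ.suc k)) (ℕP.n∸n≡0 k))
                          (trans (ℚP.*-identityˡ _) (ℚP.*-identityʳ _))
  ... | inj₁ k<d = begin
    (gauss d (ℕ.suc k) + ℕ→ℚ (q ℕ.^ (d ℕ.∸ k)) * gauss d k) * ([ ℕ.suc k ]! * [ d ℕ.∸ k ]!)
      ≡⟨ cong₂ (λ y f → (gauss d (ℕ.suc k) + y * gauss d k) * ([ ℕ.suc k ]! * [ f ]!))
               (trans (cong (λ t → ℕ→ℚ (q ℕ.^ t)) d-k≡1+e) (ℕ→ℚ-^ q (ℕ.suc e))) d-k≡1+e ⟩
    (gauss d (ℕ.suc k) + Q ^ℚ ℕ.suc e * gauss d k) * (([ k ]! * (1ℚ - Q ^ℚ ℕ.suc k)) * ([ e ]! * (1ℚ - Q ^ℚ ℕ.suc e)))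
      ≡⟨ pascal-step (gauss d (ℕ.suc k)) (gauss d k) [ k ]! [ e ]! (Q ^ℚ ℕ.suc k) (Q ^ℚ ℕ.suc e) [ d ]!
           (gauss-qFact d (ℕ.suc k) k<d)
           (trans (cong (λ t → gauss d k * ([ k ]! * [ t ]!)) (sym d-k≡1+e)) (gauss-qFact d k (ℕP.<⇒≤ k<d))) ⟩
    [ d ]! * (1ℚ - Q ^ℚ ℕ.suc e * Q ^ℚ ℕ.suc k)
      ≡⟨ cong (λ t → [ d ]! * (1ℚ - t)) (trans (sym (^ℚ-+ Q (ℕ.suc e) (ℕ.suc k))) (cong (Q ^ℚ_) exponent)) ⟩
    [ d ]! * (1ℚ - Q ^ℚ ℕ.suc d) ∎
    where
    open ≡-Reasoning
    Q = ℕ→ℚ q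
    e = d ℕ.∸ ℕ.suc k
    d-k≡1+e : d ℕ.∸ k ≡ ℕ.suc e
    d-k≡1+e = ℕP.+-∸-assoc 1 k<d
    exponent : ℕ.suc e ℕ.+ ℕ.suc k ≡ ℕ.suc d
    exponent = trans (cong (ℕ._+ ℕ.suc k) (sym d-k≡1+e))
                     (trans (ℕP.+-suc (d ℕ.∸ k) k) (cong ℕ.suc (ℕP.m∸n+n≡m (ℕP.<⇒≤ k<d))))

  gaussBinom≡gauss : ∀ d k → k ℕ.≤ d → gaussBinom q d k ≡ gauss d k
  gaussBinom≡gauss d k k≤d = div-unique [ d ]! ([ k ]! * [ d ℕ.∸ k ]!) (gauss d k)
    (x#0y#0→xy#0 ([ k ]!≢0) ([ d ℕ.∸ k ]!≢0)) (gauss-qFact d k k≤d)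

  term : ℕ → ℚ → ℕ → ℚ
  term d Y k = gauss d k * (- 1ℚ) ^ℚ k * ℕ→ℚ (q ℕ.^ (k choose 2)) * Y ^ℚ (q ℕ.^ (d ℕ.∸ k))

  Φ : ℕ → ℚ → ℚ
  Φ d Y = sum {ℕ.suc d} (λ k → term d Y (toℕ k))

  formula≡Φ : ∀ d p → formula q d p ≡ Φ d (1ℚ + p)
  formula≡Φ d p = trans (Σ≤≡sum d _) (sum-cong-≗ (λ k →
    cong (λ g → g * (- 1ℚ) ^ℚ toℕ k * ℕ→ℚ (q ℕ.^ (toℕ k choose 2)) * (1ℚ + p) ^ℚ (q ℕ.^ (d ℕ.∸ toℕ k)))
         (gaussBinom≡gauss d (toℕ k) (ℕP.≤-pred (FinP.toℕ<n k)))))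

  Φ-zero : ∀ Y → Φ 0 Y ≡ Y
  Φ-zero Y = solve 1 (λ Y → ((con 1ℚ :* con 1ℚ) :* con 1ℚ) :* (Y :* con 1ℚ) :+ con 0ℚ := Y) refl Y
    where open +-*-Solver

  Φ-suc : ∀ d Y → Φ (ℕ.suc d) Y ≡ Φ d (Y ^ℚ q) - ℕ→ℚ (q ℕ.^ d) * Φ d Y
  Φ-suc d Y = begin
    term (ℕ.suc d) Y 0 + sum {ℕ.suc d} (λ k → term (ℕ.suc d) Y (ℕ.suc (toℕ k)))
      ≡⟨ cong (term (ℕ.suc d) Y 0 +_) (trans (sum-cong-≗ {ℕ.suc d} (λ k → pascal (toℕ k) (FinP.toℕ<n k)))
           (trans (sum-- {ℕ.suc d} (λ k → A (toℕ k)) (λ k → c * term d Y (toℕ k)))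
                  (cong (λ x → sum {ℕ.suc d} (λ k → A (toℕ k)) - x) (sym (*-distribˡ-sum {ℕ.suc d} c (λ k → term d Y (toℕ k))))))) ⟩
    term (ℕ.suc d) Y 0 + (sum {ℕ.suc d} (λ k → A (toℕ k)) - c * Φ d Y)
      ≡⟨ cong (λ x → term (ℕ.suc d) Y 0 + (x - c * Φ d Y)) (sum-init-last {d} (λ k → A (toℕ k))) ⟩
    term (ℕ.suc d) Y 0 + ((sum {d} (λ k → A (toℕ (Fin.inject₁ k))) + A (toℕ (Fin.fromℕ d))) - c * Φ d Y)
      ≡⟨ cong (λ x → term (ℕ.suc d) Y 0 + ((sum {d} (λ k → A (toℕ (Fin.inject₁ k))) + x) - c * Φ d Y))
              (trans (cong A (FinP.toℕ-fromℕ d)) A-top) ⟩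
    term (ℕ.suc d) Y 0 + ((sum {d} (λ k → A (toℕ (Fin.inject₁ k))) + 0ℚ) - c * Φ d Y)
      ≡⟨ regroup (term (ℕ.suc d) Y 0) (sum {d} (λ k → A (toℕ (Fin.inject₁ k)))) (c * Φ d Y) ⟩
    (term (ℕ.suc d) Y 0 + sum {d} (λ k → A (toℕ (Fin.inject₁ k)))) - c * Φ d Y
      ≡⟨ cong (λ x → x - c * Φ d Y) (cong₂ _+_ top-term (sum-cong-≗ {d} (λ k →
           trans (cong A (FinP.toℕ-inject₁ k)) (A≡term-Y^q (toℕ k) (FinP.toℕ<n k))))) ⟩
    Φ d (Y ^ℚ q) - c * Φ d Y ∎
    where
    open ≡-Reasoning
    open +-*-Solver
    c = ℕ→ℚ (q ℕ.^ d)
    A : ℕ → ℚ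
    A k = gauss d (ℕ.suc k) * (- 1ℚ) ^ℚ ℕ.suc k * ℕ→ℚ (q ℕ.^ (ℕ.suc k choose 2)) * Y ^ℚ (q ℕ.^ (d ℕ.∸ k))

    regroup : ∀ t s x → t + ((s + 0ℚ) - x) ≡ (t + s) - x
    regroup = solve 3 (λ t s x → t :+ ((s :+ con 0ℚ) :- x) := (t :+ s) :- x) refl

    pascal : ∀ k → k ℕ.< ℕ.suc d → term (ℕ.suc d) Y (ℕ.suc k) ≡ A k - c * term d Y k
    pascal k k<1+d = begin
      (g₁ + P * g₀) * m * K * Z
        ≡⟨ split g₁ (P * g₀) m K Z ⟩
      A k + P * g₀ * m * K * Z
        ≡⟨ cong (λ K → A k + P * g₀ * m * K * Z) C[k+1]≡ ⟩
      A k + P * g₀ * ((- 1ℚ) * s) * (C * R) * Z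
        ≡⟨ cong (A k +_) (sign P g₀ s C R Z) ⟩
      A k - (P * R) * term d Y k
        ≡⟨ cong (λ x → A k - x * term d Y k) P*R≡c ⟩
      A k - c * term d Y k ∎
      where
      g₁ = gauss d (ℕ.suc k)
      g₀ = gauss d k
      s = (- 1ℚ) ^ℚ k
      m = (- 1ℚ) ^ℚ ℕ.suc k
      P = ℕ→ℚ (q ℕ.^ (d ℕ.∸ k))
      K = ℕ→ℚ (q ℕ.^ (ℕ.suc k choose 2))
      C = ℕ→ℚ (q ℕ.^ (k choose 2))
      R = ℕ→ℚ (q ℕ.^ k)
      Z = Y ^ℚ (q ℕ.^ (d ℕ.∸ k))
      split : ∀ a b m K Z → (a + b) * m * K * Z ≡ a * m * K * Z + b * m * K * Z
      split = solve 5 (λ a b m K Z → (a :+ b) :* m :* K :* Z := a :* m :* K :* Z :+ b :* m :* K :* Z) refl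
      sign : ∀ P g s C R Z → P * g * ((- 1ℚ) * s) * (C * R) * Z ≡ - ((P * R) * (g * s * C * Z))
      sign = solve 6 (λ P g s C R Z → P :* g :* ((:- con 1ℚ) :* s) :* (C :* R) :* Z
                                      := :- ((P :* R) :* (g :* s :* C :* Z))) refl
      C[k+1]≡ : K ≡ C * R
      C[k+1]≡ = trans (cong (λ t → ℕ→ℚ (q ℕ.^ t)) (C2-suc k))
                      (trans (cong ℕ→ℚ (ℕP.^-distribˡ-+-* q (k choose 2) k)) (ℕ→ℚ-* (q ℕ.^ (k choose 2)) (q ℕ.^ k)))
      P*R≡c : P * R ≡ c
      P*R≡c = trans (sym (ℕ→ℚ-* (q ℕ.^ (d ℕ.∸ k)) (q ℕ.^ k)))
                    (cong ℕ→ℚ (trans (sym (ℕP.^-distribˡ-+-* q (d ℕ.∸ k) k)) (cong (q ℕ.^_) (ℕP.m∸n+n≡m (ℕP.≤-pred k<1+d)))))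

    A-top : A d ≡ 0ℚ
    A-top = begin
      gauss d (ℕ.suc d) * (- 1ℚ) ^ℚ ℕ.suc d * K * Z
        ≡⟨ cong (λ g → g * (- 1ℚ) ^ℚ ℕ.suc d * K * Z) (gauss-above d (ℕ.suc d) (ℕP.n<1+n d)) ⟩
      0ℚ * (- 1ℚ) ^ℚ ℕ.suc d * K * Z
        ≡⟨ solve 3 (λ s K Z → con 0ℚ :* s :* K :* Z := con 0ℚ) refl ((- 1ℚ) ^ℚ ℕ.suc d) K Z ⟩
      0ℚ ∎
      where
      K = ℕ→ℚ (q ℕ.^ (ℕ.suc d choose 2))
      Z = Y ^ℚ (q ℕ.^ (d ℕ.∸ d))

    top-term : term (ℕ.suc d) Y 0 ≡ term d (Y ^ℚ q) 0
    top-term = cong (1ℚ * 1ℚ * ℕ→ℚ 1 *_) (sym (^ℚ-* Y q (q ℕ.^ d)))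

    A≡term-Y^q : ∀ k → k ℕ.< d → A k ≡ term d (Y ^ℚ q) (ℕ.suc k)
    A≡term-Y^q k k<d = cong (gauss d (ℕ.suc k) * (- 1ℚ) ^ℚ ℕ.suc k * ℕ→ℚ (q ℕ.^ (ℕ.suc k choose 2)) *_)
      (trans (cong (λ t → Y ^ℚ (q ℕ.^ t)) (ℕP.+-∸-assoc 1 k<d)) (sym (^ℚ-* Y q (q ℕ.^ (d ℕ.∸ ℕ.suc k)))))

module _ {q : ℕ} (F : FieldOn q) (1<q : 1 ℕ.< q) where
  open Counting F
  open GaussianBinomial q 1<q

  spanWeight≡Φ : ∀ d w → spanWeight d w ≡ Φ d (1ℚ + w)
  spanWeight≡Φ ℕ.zero    w = trans (spanWeight-zero w) (sym (Φ-zero (1ℚ + w)))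
  spanWeight≡Φ (ℕ.suc d) w = begin
    spanWeight (ℕ.suc d) w
      ≡⟨ spanWeight-suc d w ⟩
    spanWeight d ((1ℚ + w) ^ℚ q - 1ℚ) - ℕ→ℚ (q ℕ.^ d) * spanWeight d w
      ≡⟨ cong₂ (λ x y → x - ℕ→ℚ (q ℕ.^ d) * y) (spanWeight≡Φ d ((1ℚ + w) ^ℚ q - 1ℚ)) (spanWeight≡Φ d w) ⟩
    Φ d (1ℚ + ((1ℚ + w) ^ℚ q - 1ℚ)) - ℕ→ℚ (q ℕ.^ d) * Φ d (1ℚ + w)
      ≡⟨ cong (λ Y → Φ d Y - ℕ→ℚ (q ℕ.^ d) * Φ d (1ℚ + w)) (1+[x-1]≡x ((1ℚ + w) ^ℚ q)) ⟩
    Φ d ((1ℚ + w) ^ℚ q) - ℕ→ℚ (q ℕ.^ d) * Φ d (1ℚ + w)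
      ≡⟨ Φ-suc d (1ℚ + w) ⟨
    Φ (ℕ.suc d) (1ℚ + w) ∎
    where
    open ≡-Reasoning
    1+[x-1]≡x : ∀ x → 1ℚ + (x - 1ℚ) ≡ x
    1+[x-1]≡x = solve 1 (λ x → con 1ℚ :+ (x :- con 1ℚ) := x) refl
      where open +-*-Solver

primePower>1 : ∀ {q} → IsPrimePower q → 1 ℕ.< q
primePower>1 (r , k , r-prime , 1≤k , refl) = ℕP.^-monoʳ-< r (ℕ.nonTrivial⇒n>1 r {{prime⇒nonTrivial r-prime}}) 1≤k

mainTheorem6 : (q : ℕ) → IsPrimePower q → (F : FieldOn q) → (d : ℕ) →
               (p : ℚ) → 0ℚ ≤ p → p ≤ 1ℚ →
               expectedSpanning F d p ≡ formula q d p
mainTheorem6 q q-prime-power F d p _ _ = begin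
  expectedSpanning F d p     ≡⟨ Counting.expectedSpanning≡spanWeight F d p ⟩
  Counting.spanWeight F d p  ≡⟨ spanWeight≡Φ F 1<q d p ⟩
  Φ d (1ℚ + p)               ≡⟨ formula≡Φ d p ⟨
  formula q d p              ∎
  where
  open ≡-Reasoning
  1<q = primePower>1 q-prime-power
  open GaussianBinomial q 1<q using (Φ; formula≡Φ)
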